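{- Let $G$ be any graph with $n$ vertices. Then the expected characteristic polynomial $\mathbb{E}(\det(xI-S))$, over the uniform distribution on the Seidel matrices $S$ of $G$, is \[\sum_{k=0}^{\lfloor n/2\rfloor} m_k\,x^{n-2k},\] where $m_k$ is the number of matchings of $G$ having exactly $k$ edges.
   Context: For a (simple) graph $G$ on vertices $1,\dots,n$, a Seidel matrix of $G$ is an $n\times n$ skew-symmetric matrix $S=[s_{ij}]$ with $s_{ij}\in\{\pm1\}$ if $ij$ is an edge of $G$ and $s_{ij}=0$ otherwise (these correspond to orientations of $G$); the uniform distribution gives each of the $2^{|E(G)|}$ such matrices equal probability. A matching is a set of pairwise vertex-disjoint edges; $m_0=1$. -}

module Defs where

open import Data.Bool using (Bool; true; false; _∧_; _∨_; not; if_then_else_)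
open import Data.Nat as ℕ using (ℕ; zero; suc; _∸_; ⌊_/2⌋)
open import Data.Nat.Properties as ℕP using ()
open import Data.Integer as ℤ using (ℤ; +_; -[1+_])
import Data.Integer.Properties as ℤP
open import Data.Fin as Fin using (Fin; zero; suc; toℕ; punchIn)
import Data.Fin.Properties as FinP
open import Data.List using (List; []; _∷_; map; concatMap; filter; length; foldr; allFin; upTo; _++_)
open import Data.Bool.ListAction using (and)
open import Data.Product using (_×_; _,_; proj₁; proj₂)
open import Data.Rational as ℚ using (ℚ; 0ℚ; 1ℚ; _+_; _*_; _-_; -_)
open import Relation.Nullary.Decidable using (⌊_⌋)
open import Relation.Binary.PropositionalEquality using (_≡_)

-- Simple graphs on the vertex set Fin n (vertices 1..n ↦ 0..n-1)

record Graph (n : ℕ) : Set where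
  field
    adj     : Fin n → Fin n → Bool
    sym     : ∀ i j → adj i j ≡ adj j i
    irrefl  : ∀ i → adj i i ≡ false
open Graph public

Mat : ℕ → Set → Set
Mat n A = Fin n → Fin n → A

allFuns : {A : Set} → List A → (m : ℕ) → List (Fin m → A)
allFuns xs zero    = (λ ()) ∷ []
allFuns xs (suc m) =
  concatMap (λ a → map (λ f → λ { zero → a ; (suc i) → f i }) (allFuns xs m)) xs

allPairs : (n : ℕ) → List (Fin n × Fin n)
allPairs n = concatMap (λ i → map (λ j → i , j) (allFin n)) (allFin n)

allB : {n : ℕ} → (Fin n → Fin n → Bool) → Bool
allB {n} p = and (map (λ ij → p (proj₁ ij) (proj₂ ij)) (allPairs n))

-- all sublists (= subsets of a list of distinct elements)
sublists : {A : Set} → List A → List (List A)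
sublists []       = [] ∷ []
sublists (x ∷ xs) = let r = sublists xs in r ++ map (x ∷_) r

_==ℤ_ : ℤ → ℤ → Bool
a ==ℤ b = ⌊ a ℤP.≟ b ⌋

_==F_ : {n : ℕ} → Fin n → Fin n → Bool
a ==F b = ⌊ a FinP.≟ b ⌋

isSeidel : {n : ℕ} → Graph n → Mat n ℤ → Bool
isSeidel G S = allB (λ i j →
  (if adj G i j
     then (S i j ==ℤ (+ 1)) ∨ (S i j ==ℤ -[1+ 0 ])
     else (S i j ==ℤ (+ 0)))
  ∧ (S i j ==ℤ (ℤ.- (S j i))))

-- the finite set (list without repetition) of all Seidel matrices of G
seidelMatrices : {n : ℕ} → Graph n → List (Mat n ℤ)
seidelMatrices {n} G =
  filter (λ S → isSeidel G S ≟B true)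
         (allFuns (allFuns (-[1+ 0 ] ∷ + 0 ∷ + 1 ∷ []) n) n)
  where
    open import Data.Bool.Properties renaming (_≟_ to _≟B_)

sumℚ : List ℚ → ℚ
sumℚ = foldr _+_ 0ℚ

powℚ : ℚ → ℕ → ℚ
powℚ x zero    = 1ℚ
powℚ x (suc k) = x * powℚ x k

signℚ : ℕ → ℚ
signℚ zero          = 1ℚ
signℚ (suc zero)    = - 1ℚ
signℚ (suc (suc k)) = signℚ k

fromℤ : ℤ → ℚ
fromℤ z = z ℚ./ 1

-- expectation over the uniform distribution on a finite list
-- (average; the empty list is given mean 0, irrelevant here)
mean : List ℚ → ℚ
mean xs with length xs
... | zero  = 0ℚ
... | suc k = sumℚ xs * ((+ 1) ℚ./ suc k)

det : (n : ℕ) → Mat n ℚ → ℚ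
det zero    A = 1ℚ
det (suc n) A =
  sumℚ (map (λ j → signℚ (toℕ j) * (A zero j * det n (λ r c → A (suc r) (punchIn j c))))
            (allFin (suc n)))

charPolyAt : {n : ℕ} → Mat n ℤ → ℚ → ℚ
charPolyAt {n} S x =
  det n (λ i j → (if i ==F j then x else 0ℚ) - fromℤ (S i j))

expectedCharPolyAt : {n : ℕ} → Graph n → ℚ → ℚ
expectedCharPolyAt G x = mean (map (λ S → charPolyAt S x) (seidelMatrices G))

edges : {n : ℕ} → Graph n → List (Fin n × Fin n)
edges {n} G = filter (λ e → (adj G (proj₁ e) (proj₂ e) ∧ ⌊ proj₁ e Fin.<? proj₂ e ⌋) ≟B true)
                     (allPairs n)
  where
    open import Data.Bool.Properties renaming (_≟_ to _≟B_)

disjointEdges : {n : ℕ} → Fin n × Fin n → Fin n × Fin n → Bool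
disjointEdges (a , b) (c , d) =
  not (a ==F c) ∧ not (a ==F d) ∧ not (b ==F c) ∧ not (b ==F d)

pairwiseDisjoint : {n : ℕ} → List (Fin n × Fin n) → Bool
pairwiseDisjoint []       = true
pairwiseDisjoint (e ∷ es) = and (map (disjointEdges e) es) ∧ pairwiseDisjoint es

matchingCount : {n : ℕ} → Graph n → ℕ → ℕ
matchingCount G k = length (filter (λ M → (pairwiseDisjoint M ∧ ⌊ length M ℕ.≟ k ⌋) ≟B true)
                                   (sublists (edges G)))
  where
    open import Data.Bool.Properties renaming (_≟_ to _≟B_)

matchingPolyAt : {n : ℕ} → Graph n → ℚ → ℚ
matchingPolyAt {n} G x =
  sumℚ (map (λ k → fromℤ (+ matchingCount G k) * powℚ x (n ∸ 2 ℕ.* k))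
            (upTo (suc ⌊ n /2⌋)))

-- Write A = xI − S.  For an injective ι : Fin m → Fin n let μ(ι) be the sum of the principal
-- minors det A[ι, ι] over all Seidel matrices S of G.  We show μ(ι) = N · p(G[ι]), where N is the
-- number of Seidel matrices and p(H) is the matching polynomial of H; for ι = id this says that
-- the average of det(xI − S) is p(G).
-- Expanding along the row of u = ι 0 and then along the column of u gives
--   det A[ι, ι] = x · det A[ι − u] + Σ_{v, v′} ± s_{uv} s_{uv′} · det A[ι − u − v′, ι − u − v].
-- Negating s_{uv} and s_{vu} is a bijection on the Seidel matrices fixing every other entry, so
-- the terms with v′ ≠ v cancel in the sum, while s_{uv}² is 1 or 0 according as uv is an edge.
-- Thus μ satisfies the recurrence p(H) = x · p(H − u) + Σ_{v ∼ u} p(H − u − v), which the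
-- matching polynomial obeys because a matching either misses u or contains exactly one edge uv.

module Submission where

open import Defs hiding (sym)
open import Data.Bool as Bool using (Bool; true; false; _∧_; _∨_; not; if_then_else_; T)
import Data.Bool.Properties as BoolP
open import Data.Fin as Fin using (Fin; zero; suc; toℕ; punchIn)
import Data.Fin.Properties as FinP
open import Data.Integer as ℤ using (ℤ; 0ℤ; 1ℤ; -1ℤ; -[1+_])
import Data.Integer.Properties as ℤP
open import Data.List as List using (List; []; _∷_; _++_; map; concatMap; filter; filterᵇ; length; allFin; tabulate; applyUpTo)
import Data.List.Properties as ListP
open import Data.Nat as ℕ using (ℕ; zero; suc; _∸_; ⌊_/2⌋)
import Data.Nat.Properties as ℕP
import Data.Nat.Coprimality as Coprime
open import Data.Rational as ℚ using (ℚ; 0ℚ; 1ℚ; _+_; _*_; _-_; -_; mkℚ)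
import Data.Rational.Properties as ℚP
open import Algebra.Bundles using (CommutativeRing)
open import Algebra.Properties.Semiring.Sum (CommutativeRing.semiring ℚP.+-*-commutativeRing)
  using (sum; sum-syntax; sum-cong-≗; sum-replicate-zero; sum-remove; ∑-distrib-+; ∑-comm; *-distribˡ-sum; *-distribʳ-sum)
open import Data.Rational.Solver using (module +-*-Solver)
open import Data.Product using (_×_; _,_; proj₁; proj₂)
open import Data.Sum using (inj₁; inj₂)
open import Relation.Binary.Definitions using (tri<; tri≈; tri>)
open import Data.Vec.Functional as Vector using (Vector)
import Data.Vec.Functional.Relation.Binary.Equality.Setoid as Pointwise
open import Data.List.Relation.Unary.Any as Any using (Any; here; there)
import Data.List.Relation.Unary.Any.Properties as AnyP
import Data.List.Relation.Unary.All as All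
import Data.List.Relation.Unary.All.Properties as AllP
open import Data.List.Membership.Propositional using (_∈_)
open import Data.List.Membership.Propositional.Properties using (∈-map⁺; ∈-concatMap⁺; ∈-allFin)
open import Data.Bool.ListAction using (and; all)
open import Function.Definitions using (Injective)
open import Function using (_∘_; id; const; _⇔_; mk⇔; Equivalence)
open import Level using (0ℓ)
open import Relation.Binary.Bundles using (Setoid)
open import Relation.Binary.Core using (_Preserves_⟶_)
open import Relation.Binary.PropositionalEquality
open import Relation.Nullary using (¬_; Dec; yes; no)
open import Relation.Nullary.Decidable using (⌊_⌋; toWitness; isYes≗does; dec-true; dec-false; does-⇔; T?)

open ≡-Reasoning
open +-*-Solver

fromℕ : ℕ → ℚ
fromℕ k = fromℤ (ℤ.+ k)

fromℕ-+ : ∀ a b → fromℕ (a ℕ.+ b) ≡ fromℕ a + fromℕ b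
fromℕ-+ a b = begin
  fromℕ (a ℕ.+ b)
    ≡⟨ cong (ℚ._/ 1) (cong₂ ℤ._+_ (sym (ℤP.*-identityʳ (ℤ.+ a))) (sym (ℤP.*-identityʳ (ℤ.+ b)))) ⟩
  mkℚ (ℤ.+ a) 0 (coprime a) + mkℚ (ℤ.+ b) 0 (coprime b)
    ≡⟨ cong₂ _+_ (sym (fromℕ≡mkℚ a)) (sym (fromℕ≡mkℚ b)) ⟩
  fromℕ a + fromℕ b
    ∎
  where
  coprime : ∀ k → Coprime.Coprime k 1
  coprime k = Coprime.sym (Coprime.1-coprimeTo k)
  fromℕ≡mkℚ : ∀ k → fromℕ k ≡ mkℚ (ℤ.+ k) 0 (coprime k)
  fromℕ≡mkℚ k = ℚP.normalize-coprime (coprime k)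

fromℕ-suc-*-inverse : ∀ k → fromℕ (suc k) * (ℤ.+ 1 ℚ./ suc k) ≡ 1ℚ
fromℕ-suc-*-inverse k = trans
  (cong₂ _*_ (ℚP.normalize-coprime (Coprime.sym (Coprime.1-coprimeTo (suc k)))) (ℚP.normalize-coprime (Coprime.1-coprimeTo (suc k))))
  (ℚP.*-inverseʳ (mkℚ (ℤ.+ suc k) 0 (Coprime.sym (Coprime.1-coprimeTo (suc k)))))

fromℤ-neg : ∀ z → fromℤ (ℤ.- z) ≡ - fromℤ z
fromℤ-neg (ℤ.+ zero)    = refl
fromℤ-neg (ℤ.+ (suc k)) = refl
fromℤ-neg -[1+ k ]      = solve 1 (λ q → q := :- (:- q)) refl (fromℤ (ℤ.+ suc k))

p≡-p⇒p≡0 : ∀ q → q ≡ - q → q ≡ 0ℚ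
p≡-p⇒p≡0 q q≡-q = begin
  q                        ≡⟨ solve 1 (λ q → q := con ½ :* (q :+ q)) refl q ⟩
  ½ * (q + q)              ≡⟨ cong (λ r → ½ * (q + r)) q≡-q ⟩
  ½ * (q + - q)            ≡⟨ solve 1 (λ q → con ½ :* (q :+ :- q) := con 0ℚ) refl q ⟩
  0ℚ                       ∎
  where
  ½ : ℚ
  ½ = ℤ.+ 1 ℚ./ 2

signℚ-suc : ∀ k → signℚ (suc k) ≡ - signℚ k
signℚ-suc zero          = refl
signℚ-suc (suc zero)    = refl
signℚ-suc (suc (suc k)) = signℚ-suc k

signℚ-square : ∀ k → signℚ k * signℚ k ≡ 1ℚ
signℚ-square zero          = refl
signℚ-square (suc zero)    = refl
signℚ-square (suc (suc k)) = signℚ-square k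

∑-zero : ∀ {n} (f : Fin n → ℚ) → (∀ i → f i ≡ 0ℚ) → ∑[ i < n ] f i ≡ 0ℚ
∑-zero {n} f f≡0 = trans (sum-cong-≗ {x = f} f≡0) (sum-replicate-zero n)

∑-δ : ∀ {n} (f : Fin n → ℚ) (j : Fin n) → (∀ i → i ≢ j → f i ≡ 0ℚ) → ∑[ i < n ] f i ≡ f j
∑-δ {suc n} f j f≡0 = begin
  sum f                   ≡⟨ sum-remove {i = j} f ⟩
  f j + sum (f ∘ punchIn j) ≡⟨ cong (f j +_) (∑-zero (f ∘ punchIn j) (λ i → f≡0 _ (FinP.punchInᵢ≢i j i))) ⟩
  f j + 0ℚ                ≡⟨ ℚP.+-identityʳ (f j) ⟩
  f j                     ∎

∑-pad : ∀ K d (f : ℕ → ℚ) → (∀ i → f (K ℕ.+ i) ≡ 0ℚ) → ∑[ k < K ℕ.+ d ] f (toℕ k) ≡ ∑[ k < K ] f (toℕ k)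
∑-pad zero    d f f≡0 = ∑-zero {d} (f ∘ toℕ) (f≡0 ∘ toℕ)
∑-pad (suc K) d f f≡0 = cong (f 0 +_) (∑-pad K d (f ∘ suc) f≡0)

∑-if : ∀ {K} b (f : Fin K → ℚ) → ∑[ k < K ] (if b then f k else 0ℚ) ≡ (if b then sum f else 0ℚ)
∑-if {K} true  f = refl
∑-if {K} false f = sum-replicate-zero K

if-*ʳ : ∀ b p q → (if b then p else 0ℚ) * q ≡ (if b then p * q else 0ℚ)
if-*ʳ true  p q = refl
if-*ʳ false p q = ℚP.*-zeroˡ q

*-distribˡ-sum₂ : ∀ {m} x y (g : Fin m → ℚ) → x * (y * sum g) ≡ ∑[ i < m ] (x * (y * g i))
*-distribˡ-sum₂ x y g = trans (cong (x *_) (*-distribˡ-sum y g)) (*-distribˡ-sum x (λ i → y * g i))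

sumℚ-++ : ∀ xs ys → sumℚ (xs ++ ys) ≡ sumℚ xs + sumℚ ys
sumℚ-++ []       ys = sym (ℚP.+-identityˡ _)
sumℚ-++ (x ∷ xs) ys = trans (cong (x +_) (sumℚ-++ xs ys)) (sym (ℚP.+-assoc x _ _))

module _ {A : Set} where

  sumℚ-map-cong : {f g : A → ℚ} → (∀ a → f a ≡ g a) → ∀ xs → sumℚ (map f xs) ≡ sumℚ (map g xs)
  sumℚ-map-cong f≗g xs = cong sumℚ (ListP.map-cong f≗g xs)

  sumℚ-map-0 : ∀ (xs : List A) → sumℚ (map (λ _ → 0ℚ) xs) ≡ 0ℚ
  sumℚ-map-0 []       = refl
  sumℚ-map-0 (x ∷ xs) = trans (ℚP.+-identityˡ _) (sumℚ-map-0 xs)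

  sumℚ-map-+ : ∀ (f g : A → ℚ) xs → sumℚ (map (λ a → f a + g a) xs) ≡ sumℚ (map f xs) + sumℚ (map g xs)
  sumℚ-map-+ f g []       = refl
  sumℚ-map-+ f g (x ∷ xs) =
    trans (cong (f x + g x +_) (sumℚ-map-+ f g xs))
          (solve 4 (λ a b c d → (a :+ b) :+ (c :+ d) := (a :+ c) :+ (b :+ d)) refl (f x) (g x) _ _)

  sumℚ-map-* : ∀ c (f : A → ℚ) xs → sumℚ (map (λ a → c * f a) xs) ≡ c * sumℚ (map f xs)
  sumℚ-map-* c f []       = sym (ℚP.*-zeroʳ c)
  sumℚ-map-* c f (x ∷ xs) = trans (cong (c * f x +_) (sumℚ-map-* c f xs)) (sym (ℚP.*-distribˡ-+ c _ _))

  sumℚ-map-∑ : ∀ {m} (f : Fin m → A → ℚ) xs → sumℚ (map (λ a → ∑[ j < m ] f j a) xs) ≡ ∑[ j < m ] sumℚ (map (f j) xs)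
  sumℚ-map-∑ {zero}  f xs = sumℚ-map-0 xs
  sumℚ-map-∑ {suc m} f xs =
    trans (sumℚ-map-+ (f zero) _ xs) (cong (sumℚ (map (f zero) xs) +_) (sumℚ-map-∑ (f ∘ suc) xs))

  sumℚ-map-const : ∀ c (xs : List A) → sumℚ (map (λ _ → c) xs) ≡ c * fromℕ (length xs)
  sumℚ-map-const c []       = sym (ℚP.*-zeroʳ c)
  sumℚ-map-const c (x ∷ xs) = begin
    c + sumℚ (map (λ _ → c) xs)  ≡⟨ cong (c +_) (sumℚ-map-const c xs) ⟩
    c + c * fromℕ (length xs)  ≡⟨ solve 2 (λ c l → c :+ c :* l := c :* (con 1ℚ :+ l)) refl c _ ⟩
    c * (1ℚ + fromℕ (length xs)) ≡⟨ cong (c *_) (sym (fromℕ-+ 1 (length xs))) ⟩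
    c * fromℕ (suc (length xs)) ∎

  sumℚ-map-filterᵇ : ∀ (f : A → ℚ) p xs →
    sumℚ (map f (filterᵇ p xs)) ≡ sumℚ (map (λ a → if p a then f a else 0ℚ) xs)
  sumℚ-map-filterᵇ f p []       = refl
  sumℚ-map-filterᵇ f p (x ∷ xs) with p x
  ... | true  = cong (f x +_) (sumℚ-map-filterᵇ f p xs)
  ... | false = trans (sumℚ-map-filterᵇ f p xs) (sym (ℚP.+-identityˡ _))

  sumℚ-map-tabulate : ∀ {m} (f : A → ℚ) (g : Fin m → A) → sumℚ (map f (tabulate g)) ≡ ∑[ i < m ] f (g i)
  sumℚ-map-tabulate {zero}  f g = refl
  sumℚ-map-tabulate {suc m} f g = cong (f (g zero) +_) (sumℚ-map-tabulate f (g ∘ suc))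

  sumℚ-map-applyUpTo : ∀ (f : A → ℚ) (g : ℕ → A) K → sumℚ (map f (applyUpTo g K)) ≡ ∑[ i < K ] f (g (toℕ i))
  sumℚ-map-applyUpTo f g zero    = refl
  sumℚ-map-applyUpTo f g (suc K) = cong (f (g 0) +_) (sumℚ-map-applyUpTo f (g ∘ suc) K)

sumℚ-map-concatMap : ∀ {A B : Set} (f : B → ℚ) (g : A → List B) xs →
  sumℚ (map f (concatMap g xs)) ≡ sumℚ (map (λ a → sumℚ (map f (g a))) xs)
sumℚ-map-concatMap f g []       = refl
sumℚ-map-concatMap f g (x ∷ xs) = begin
  sumℚ (map f (g x ++ concatMap g xs))                 ≡⟨ cong sumℚ (ListP.map-++ f (g x) _) ⟩
  sumℚ (map f (g x) ++ map f (concatMap g xs))         ≡⟨ sumℚ-++ (map f (g x)) _ ⟩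
  sumℚ (map f (g x)) + sumℚ (map f (concatMap g xs))   ≡⟨ cong (sumℚ (map f (g x)) +_) (sumℚ-map-concatMap f g xs) ⟩
  sumℚ (map (λ a → sumℚ (map f (g a))) (x ∷ xs))       ∎

mean-≡ : ∀ ys c → 0 ℕ.< length ys → sumℚ ys ≡ c * fromℕ (length ys) → mean ys ≡ c
mean-≡ ys c 0<len sum≡ with length ys
... | suc k = begin
  sumℚ ys * (ℤ.+ 1 ℚ./ suc k)              ≡⟨ cong (_* (ℤ.+ 1 ℚ./ suc k)) sum≡ ⟩
  c * fromℕ (suc k) * (ℤ.+ 1 ℚ./ suc k)    ≡⟨ ℚP.*-assoc c _ _ ⟩
  c * (fromℕ (suc k) * (ℤ.+ 1 ℚ./ suc k))  ≡⟨ cong (c *_) (fromℕ-suc-*-inverse k) ⟩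
  c * 1ℚ                                   ≡⟨ ℚP.*-identityʳ c ⟩
  c                                        ∎

module _ {a} {A : Set a} where

  ⌊⌋-true : (a? : Dec A) → A → ⌊ a? ⌋ ≡ true
  ⌊⌋-true a? x = trans (isYes≗does a?) (dec-true a? x)

  ⌊⌋-false : (a? : Dec A) → ¬ A → ⌊ a? ⌋ ≡ false
  ⌊⌋-false a? ¬x = trans (isYes≗does a?) (dec-false a? ¬x)

  ⌊⌋-⇔ : ∀ {b} {B : Set b} → A ⇔ B → (a? : Dec A) (b? : Dec B) → ⌊ a? ⌋ ≡ ⌊ b? ⌋
  ⌊⌋-⇔ A⇔B a? b? = trans (isYes≗does a?) (trans (does-⇔ A⇔B a? b?) (sym (isYes≗does b?)))

==ℤ-sound : ∀ a b → T (a ==ℤ b) → a ≡ b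
==ℤ-sound a b = toWitness {a? = a ℤP.≟ b}

==ℤ-neg : ∀ a b → ((ℤ.- a) ==ℤ (ℤ.- b)) ≡ (a ==ℤ b)
==ℤ-neg a b = ⌊⌋-⇔ (mk⇔ ℤP.neg-injective (cong (λ z → ℤ.- z))) _ _

==F-refl : ∀ {n} (i : Fin n) → (i ==F i) ≡ true
==F-refl i = ⌊⌋-true (i FinP.≟ i) refl

==F-false : ∀ {n} {i j : Fin n} → i ≢ j → (i ==F j) ≡ false
==F-false {i = i} {j} = ⌊⌋-false (i FinP.≟ j)

module _ {A : Set} where

  filter-≡true : (p : A → Bool) → filter (λ x → p x Bool.≟ true) ≗ filterᵇ p
  filter-≡true p = ListP.filter-≐ (λ x → p x Bool.≟ true) (T? ∘ p)
    (Equivalence.from BoolP.T-≡ , Equivalence.to BoolP.T-≡)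

  filterᵇ-cong : {p q : A → Bool} → p ≗ q → filterᵇ p ≗ filterᵇ q
  filterᵇ-cong p≗q []       = refl
  filterᵇ-cong {p} {q} p≗q (x ∷ xs) rewrite p≗q x with q x
  ... | true  = cong (x ∷_) (filterᵇ-cong p≗q xs)
  ... | false = filterᵇ-cong p≗q xs

  filterᵇ-reject : (p : A → Bool) {x : A} (xs : List A) → p x ≡ false → filterᵇ p (x ∷ xs) ≡ filterᵇ p xs
  filterᵇ-reject p xs px rewrite px = refl

  filterᵇ-none : (p : A → Bool) → (∀ x → p x ≡ false) → filterᵇ p ≗ const []
  filterᵇ-none p p≡false []       = refl
  filterᵇ-none p p≡false (x ∷ xs) rewrite p≡false x = filterᵇ-none p p≡false xs

  filterᵇ-all : (p : A → Bool) → (∀ x → p x ≡ true) → filterᵇ p ≗ id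
  filterᵇ-all p p≡true []       = refl
  filterᵇ-all p p≡true (x ∷ xs) rewrite p≡true x = cong (x ∷_) (filterᵇ-all p p≡true xs)

  filterᵇ-filterᵇ : (p q : A → Bool) → filterᵇ p ∘ filterᵇ q ≗ filterᵇ (λ x → q x ∧ p x)
  filterᵇ-filterᵇ p q []       = refl
  filterᵇ-filterᵇ p q (x ∷ xs) with q x
  ... | false = filterᵇ-filterᵇ p q xs
  ... | true with p x
  ...   | true  = cong (x ∷_) (filterᵇ-filterᵇ p q xs)
  ...   | false = filterᵇ-filterᵇ p q xs

  filterᵇ-++ : (p : A → Bool) (xs ys : List A) → filterᵇ p (xs ++ ys) ≡ filterᵇ p xs ++ filterᵇ p ys
  filterᵇ-++ p = ListP.filter-++ (T? ∘ p)

module _ {A B : Set} where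

  filterᵇ-map : (p : B → Bool) (f : A → B) → filterᵇ p ∘ map f ≗ map f ∘ filterᵇ (p ∘ f)
  filterᵇ-map p f []       = refl
  filterᵇ-map p f (x ∷ xs) with p (f x)
  ... | true  = cong (f x ∷_) (filterᵇ-map p f xs)
  ... | false = filterᵇ-map p f xs

  concatMap-filterᵇ : (f : A → List B) (p : A → Bool) →
    concatMap f ∘ filterᵇ p ≗ concatMap (λ a → if p a then f a else [])
  concatMap-filterᵇ f p []       = refl
  concatMap-filterᵇ f p (x ∷ xs) with p x
  ... | true  = cong (f x ++_) (concatMap-filterᵇ f p xs)
  ... | false = concatMap-filterᵇ f p xs

  filterᵇ-concatMap : (p : B → Bool) (f : A → List B) → filterᵇ p ∘ concatMap f ≗ concatMap (filterᵇ p ∘ f)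
  filterᵇ-concatMap p f []       = refl
  filterᵇ-concatMap p f (x ∷ xs) =
    trans (filterᵇ-++ p (f x) _) (cong (filterᵇ p (f x) ++_) (filterᵇ-concatMap p f xs))

module _ {A : Set} where

  and-map⁻ : (f : A → Bool) {xs : List A} {x : A} → T (and (map f xs)) → x ∈ xs → T (f x)
  and-map⁻ f {y ∷ ys} t (here refl) = proj₁ (Equivalence.to BoolP.T-∧ t)
  and-map⁻ f {y ∷ ys} t (there x∈) = and-map⁻ f (proj₂ (Equivalence.to BoolP.T-∧ t)) x∈

  and-map⁺ : (f : A → Bool) → (∀ x → T (f x)) → ∀ xs → T (and (map f xs))
  and-map⁺ f Tf []       = _
  and-map⁺ f Tf (x ∷ xs) = Equivalence.from BoolP.T-∧ (Tf x , and-map⁺ f Tf xs)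

module _ {n : ℕ} where

  ∈-allPairs : (i j : Fin n) → (i , j) ∈ allPairs n
  ∈-allPairs i j = ∈-concatMap⁺ _ (Any.map (λ { refl → ∈-map⁺ (i ,_) (∈-allFin j) }) (∈-allFin i))

  allB⁻ : (p : Fin n → Fin n → Bool) → T (allB p) → ∀ i j → T (p i j)
  allB⁻ p t i j = and-map⁻ _ t (∈-allPairs i j)

  allB⁺ : (p : Fin n → Fin n → Bool) → (∀ i j → T (p i j)) → T (allB p)
  allB⁺ p Tp = and-map⁺ _ (λ ij → Tp (proj₁ ij) (proj₂ ij)) (allPairs n)

  allB-cong : {p q : Fin n → Fin n → Bool} → (∀ i j → p i j ≡ q i j) → allB p ≡ allB q
  allB-cong p≗q = cong and (ListP.map-cong (λ ij → p≗q (proj₁ ij) (proj₂ ij)) (allPairs n))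

-- Sums over function spaces

module AllFuns {ℓ} (A : Setoid 0ℓ ℓ) where

  open Setoid A using (Carrier; _≈_) renaming (refl to ≈-refl)
  open import Data.Vec.Functional.Relation.Binary.Equality.Setoid A using (_≋_)

  sumℚ-allFuns-suc : ∀ xs m (Ψ : Vector Carrier (suc m) → ℚ) → Ψ Preserves _≋_ ⟶ _≡_ →
    sumℚ (map Ψ (allFuns xs (suc m))) ≡ sumℚ (map (λ a → sumℚ (map (λ f → Ψ (a Vector.∷ f)) (allFuns xs m))) xs)
  sumℚ-allFuns-suc xs m Ψ Ψ-resp = trans (sumℚ-map-concatMap Ψ _ xs) (sumℚ-map-cong (λ a →
    trans (cong sumℚ (sym (ListP.map-∘ (allFuns xs m))))
          (sumℚ-map-cong (λ f → Ψ-resp λ { zero → ≈-refl ; (suc i) → ≈-refl }) (allFuns xs m))) xs)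

  sumℚ-allFuns-invariant : ∀ xs {m} (t : Fin m → Carrier → Carrier) →
    (∀ i → t i Preserves _≈_ ⟶ _≈_) →
    (∀ i (g : Carrier → ℚ) → g Preserves _≈_ ⟶ _≡_ → sumℚ (map g xs) ≡ sumℚ (map (g ∘ t i) xs)) →
    (Ψ : Vector Carrier m → ℚ) → Ψ Preserves _≋_ ⟶ _≡_ →
    sumℚ (map Ψ (allFuns xs m)) ≡ sumℚ (map (λ f → Ψ (λ i → t i (f i))) (allFuns xs m))
  sumℚ-allFuns-invariant xs {zero}  t t-resp t-inv Ψ Ψ-resp = cong (_+ 0ℚ) (Ψ-resp λ ())
  sumℚ-allFuns-invariant xs {suc m} t t-resp t-inv Ψ Ψ-resp = begin
    sumℚ (map Ψ (allFuns xs (suc m)))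
      ≡⟨ sumℚ-allFuns-suc xs m Ψ Ψ-resp ⟩
    sumℚ (map h xs)
      ≡⟨ t-inv zero h h-resp ⟩
    sumℚ (map (h ∘ t zero) xs)
      ≡⟨ sumℚ-map-cong (λ a → sumℚ-allFuns-invariant xs (t ∘ suc) (t-resp ∘ suc) (t-inv ∘ suc)
                                (λ f → Ψ (t zero a Vector.∷ f)) (Ψ-resp ∘ ≋-cons ≈-refl)) xs ⟩
    sumℚ (map (λ a → sumℚ (map (λ f → Ψ (t zero a Vector.∷ (λ i → t (suc i) (f i)))) (allFuns xs m))) xs)
      ≡⟨ sumℚ-map-cong (λ a → sumℚ-map-cong (λ f → Ψ-resp λ { zero → ≈-refl ; (suc i) → ≈-refl }) (allFuns xs m)) xs ⟨
    sumℚ (map (λ a → sumℚ (map (λ f → Ψ (λ i → t i ((a Vector.∷ f) i))) (allFuns xs m))) xs)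
      ≡⟨ sumℚ-allFuns-suc xs m (λ f → Ψ (λ i → t i (f i))) (λ f≋g → Ψ-resp (λ i → t-resp i (f≋g i))) ⟨
    sumℚ (map (λ f → Ψ (λ i → t i (f i))) (allFuns xs (suc m)))
      ∎
    where
    ≋-cons : ∀ {k a b} {f g : Vector Carrier k} → a ≈ b → f ≋ g → (a Vector.∷ f) ≋ (b Vector.∷ g)
    ≋-cons a≈b f≋g zero    = a≈b
    ≋-cons a≈b f≋g (suc i) = f≋g i
    h : Carrier → ℚ
    h a = sumℚ (map (λ f → Ψ (a Vector.∷ f)) (allFuns xs m))
    h-resp : h Preserves _≈_ ⟶ _≡_
    h-resp a≈b = sumℚ-map-cong (λ f → Ψ-resp (≋-cons a≈b (λ _ → ≈-refl))) (allFuns xs m)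

  allFuns-complete : ∀ xs m (f : Vector Carrier m) → (∀ i → Any (_≈ f i) xs) → Any (_≋ f) (allFuns xs m)
  allFuns-complete xs zero    f f∈xs = here λ ()
  allFuns-complete xs (suc m) f f∈xs = AnyP.concatMap⁺ _ (Any.map (λ {a} a≈f₀ → AnyP.map⁺
    (Any.map (λ {g} g≋f₊ → λ { zero → a≈f₀ ; (suc i) → g≋f₊ i }) (allFuns-complete xs m (f ∘ suc) (f∈xs ∘ suc))))
    (f∈xs zero))

-- Seidel matrices

ternaries : List ℤ
ternaries = -1ℤ ∷ 0ℤ ∷ 1ℤ ∷ []

ternaryMatrices : (n : ℕ) → List (Mat n ℤ)
ternaryMatrices n = allFuns (allFuns ternaries n) n

negIf : Bool → ℤ → ℤ
negIf b z = if b then ℤ.- z else z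

sumℚ-ternaries-negIf : ∀ b (g : ℤ → ℚ) → sumℚ (map g ternaries) ≡ sumℚ (map (g ∘ negIf b) ternaries)
sumℚ-ternaries-negIf false g = refl
sumℚ-ternaries-negIf true  g =
  solve 3 (λ a b c → a :+ (b :+ (c :+ con 0ℚ)) := c :+ (b :+ (a :+ con 0ℚ))) refl (g -1ℤ) (g 0ℤ) (g 1ℤ)

module _ {n : ℕ} where

  _≋ₘ_ : Mat n ℤ → Mat n ℤ → Set
  S ≋ₘ S′ = ∀ i j → S i j ≡ S′ i j

  negateAt : (Fin n → Fin n → Bool) → Mat n ℤ → Mat n ℤ
  negateAt e S i j = negIf (e i j) (S i j)

  private
    module Entries = AllFuns (setoid ℤ)
    module Rows = AllFuns (Pointwise.≋-setoid (setoid ℤ) n)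

  sumℚ-ternaryMatrices-negateAt : ∀ e (Ψ : Mat n ℤ → ℚ) → Ψ Preserves _≋ₘ_ ⟶ _≡_ →
    sumℚ (map Ψ (ternaryMatrices n)) ≡ sumℚ (map (Ψ ∘ negateAt e) (ternaryMatrices n))
  sumℚ-ternaryMatrices-negateAt e = Rows.sumℚ-allFuns-invariant (allFuns ternaries n)
    (λ i row j → negIf (e i j) (row j))
    (λ i row≋ j → cong (negIf (e i j)) (row≋ j))
    (λ i g g-resp → Entries.sumℚ-allFuns-invariant ternaries (negIf ∘ e i)
      (λ j → cong (negIf (e i j))) (λ j g′ _ → sumℚ-ternaries-negIf (e i j) g′) g g-resp)

  ∈-ternaryMatrices : (S : Mat n ℤ) → (∀ i j → S i j ∈ ternaries) → Any (_≋ₘ S) (ternaryMatrices n)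
  ∈-ternaryMatrices S S∈ = Rows.allFuns-complete (allFuns ternaries n) n S
    (λ i → Entries.allFuns-complete ternaries n (S i) (λ j → Any.map sym (S∈ i j)))

seidelEntry : Bool → ℤ → ℤ → Bool
seidelEntry edge a b = (if edge then (a ==ℤ 1ℤ) ∨ (a ==ℤ -1ℤ) else (a ==ℤ 0ℤ)) ∧ (a ==ℤ (ℤ.- b))

seidelEntry-neg : ∀ edge a b → seidelEntry edge (ℤ.- a) (ℤ.- b) ≡ seidelEntry edge a b
seidelEntry-neg true a b = cong₂ _∧_
  (trans (cong₂ _∨_ (==ℤ-neg a -1ℤ) (==ℤ-neg a 1ℤ)) (BoolP.∨-comm (a ==ℤ -1ℤ) (a ==ℤ 1ℤ)))
  (==ℤ-neg a (ℤ.- b))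
seidelEntry-neg false a b = cong₂ _∧_ (==ℤ-neg a 0ℤ) (==ℤ-neg a (ℤ.- b))

module _ {n : ℕ} (G : Graph n) where

  isSeidel-cong : ∀ {S S′} → S ≋ₘ S′ → isSeidel G S ≡ isSeidel G S′
  isSeidel-cong S≋S′ = allB-cong λ i j → cong₂ (seidelEntry (adj G i j)) (S≋S′ i j) (S≋S′ j i)

  isSeidel-negateAt : ∀ {e} → (∀ i j → e i j ≡ e j i) → ∀ S → isSeidel G (negateAt e S) ≡ isSeidel G S
  isSeidel-negateAt {e} e-sym S = allB-cong entry
    where
    entry : ∀ i j → seidelEntry (adj G i j) (negateAt e S i j) (negateAt e S j i) ≡ seidelEntry (adj G i j) (S i j) (S j i)
    entry i j rewrite e-sym j i with e i j
    ... | true  = seidelEntry-neg (adj G i j) (S i j) (S j i)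
    ... | false = refl

  seidelMatrices≡ : seidelMatrices G ≡ filterᵇ (isSeidel G) (ternaryMatrices n)
  seidelMatrices≡ = filter-≡true (isSeidel G) (ternaryMatrices n)

  seidelSum : (Mat n ℤ → ℚ) → ℚ
  seidelSum Φ = sumℚ (map Φ (seidelMatrices G))

  seidelCount : ℚ
  seidelCount = fromℕ (length (seidelMatrices G))

  seidelSum-const : ∀ c → seidelSum (λ _ → c) ≡ c * seidelCount
  seidelSum-const c = sumℚ-map-const c (seidelMatrices G)

  seidelSum-cong : ∀ {Φ Ψ} → (∀ S → T (isSeidel G S) → Φ S ≡ Ψ S) → seidelSum Φ ≡ seidelSum Ψ
  seidelSum-cong Φ≡Ψ rewrite seidelMatrices≡ = cong sumℚ (ListP.map-cong-local
    (All.map (Φ≡Ψ _) (AllP.all-filter (T? ∘ isSeidel G) (ternaryMatrices n))))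

  seidelSum-negateAt : ∀ {e} → (∀ i j → e i j ≡ e j i) → ∀ Φ → Φ Preserves _≋ₘ_ ⟶ _≡_ →
    seidelSum Φ ≡ seidelSum (Φ ∘ negateAt e)
  seidelSum-negateAt {e} e-sym Φ Φ-resp rewrite seidelMatrices≡ = begin
    sumℚ (map Φ (filterᵇ (isSeidel G) cube))
      ≡⟨ sumℚ-map-filterᵇ Φ (isSeidel G) cube ⟩
    sumℚ (map (restrict Φ) cube)
      ≡⟨ sumℚ-ternaryMatrices-negateAt e (restrict Φ) restrict-resp ⟩
    sumℚ (map (restrict Φ ∘ negateAt e) cube)
      ≡⟨ sumℚ-map-cong (λ S → cong (if_then Φ (negateAt e S) else 0ℚ) (isSeidel-negateAt e-sym S)) cube ⟩
    sumℚ (map (restrict (Φ ∘ negateAt e)) cube)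
      ≡⟨ sumℚ-map-filterᵇ (Φ ∘ negateAt e) (isSeidel G) cube ⟨
    sumℚ (map (Φ ∘ negateAt e) (filterᵇ (isSeidel G) cube))
      ∎
    where
    cube : List (Mat n ℤ)
    cube = ternaryMatrices n
    restrict : (Mat n ℤ → ℚ) → Mat n ℤ → ℚ
    restrict Ψ S = if isSeidel G S then Ψ S else 0ℚ
    restrict-resp : restrict Φ Preserves _≋ₘ_ ⟶ _≡_
    restrict-resp {S} {S′} S≋S′ = cong₂ (if_then_else 0ℚ) (isSeidel-cong S≋S′) (Φ-resp S≋S′)

  seidelSum-odd : ∀ {e} → (∀ i j → e i j ≡ e j i) → ∀ Φ → Φ Preserves _≋ₘ_ ⟶ _≡_ →
    (∀ S → Φ (negateAt e S) ≡ - Φ S) → seidelSum Φ ≡ 0ℚ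
  seidelSum-odd e-sym Φ Φ-resp Φ-odd = p≡-p⇒p≡0 (seidelSum Φ) (begin
    seidelSum Φ                            ≡⟨ seidelSum-negateAt e-sym Φ Φ-resp ⟩
    sumℚ (map (Φ ∘ negateAt _) seidels)    ≡⟨ sumℚ-map-cong (λ S → trans (Φ-odd S) (-q≡-1*q (Φ S))) seidels ⟩
    sumℚ (map (λ S → - 1ℚ * Φ S) seidels)  ≡⟨ sumℚ-map-* (- 1ℚ) Φ seidels ⟩
    - 1ℚ * seidelSum Φ                     ≡⟨ -q≡-1*q (seidelSum Φ) ⟨
    - seidelSum Φ                          ∎)
    where
    seidels : List (Mat n ℤ)
    seidels = seidelMatrices G
    -q≡-1*q : ∀ q → - q ≡ - 1ℚ * q
    -q≡-1*q = solve 1 (λ q → :- q := :- con 1ℚ :* q) refl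

  module SeidelMatrix {S : Mat n ℤ} (S-seidel : T (isSeidel G S)) where

    entry : ∀ i j → T (seidelEntry (adj G i j) (S i j) (S j i))
    entry = allB⁻ _ S-seidel

    diagonal : ∀ i → S i i ≡ 0ℤ
    diagonal i with entry i i
    ... | t rewrite irrefl G i = ==ℤ-sound (S i i) 0ℤ (proj₁ (Equivalence.to BoolP.T-∧ t))

    skew : ∀ i j → S i j ≡ ℤ.- S j i
    skew i j = ==ℤ-sound (S i j) (ℤ.- S j i) (proj₂ (Equivalence.to BoolP.T-∧ (entry i j)))

    square : ∀ i j → fromℤ (S i j) * fromℤ (S i j) ≡ (if adj G i j then 1ℚ else 0ℚ)
    square i j with adj G i j | entry i j
    ... | false | t rewrite ==ℤ-sound (S i j) 0ℤ (proj₁ (Equivalence.to BoolP.T-∧ t)) = refl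
    ... | true  | t with Equivalence.to BoolP.T-∨ (proj₁ (Equivalence.to BoolP.T-∧ t))
    ...   | inj₁ S≡1  rewrite ==ℤ-sound (S i j) 1ℤ S≡1  = refl
    ...   | inj₂ S≡-1 rewrite ==ℤ-sound (S i j) -1ℤ S≡-1 = refl

  private
    orientation : Mat n ℤ
    orientation i j = if adj G i j then (if ⌊ i Fin.<? j ⌋ then 1ℤ else -1ℤ) else 0ℤ

    orientation-seidel : T (isSeidel G orientation)
    orientation-seidel = allB⁺ _ entry
      where
      entry : ∀ i j → T (seidelEntry (adj G i j) (orientation i j) (orientation j i))
      entry i j rewrite Graph.sym G j i with adj G i j in ij
      ... | false = _
      ... | true with FinP.<-cmp i j
      ...   | tri< i<j _ j≮i rewrite ⌊⌋-true (i Fin.<? j) i<j | ⌊⌋-false (j Fin.<? i) j≮i = _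
      ...   | tri> i≮j _ j<i rewrite ⌊⌋-false (i Fin.<? j) i≮j | ⌊⌋-true (j Fin.<? i) j<i = _
      ...   | tri≈ _ refl _ with () ← trans (sym ij) (irrefl G i)

    orientation-ternary : ∀ i j → orientation i j ∈ ternaries
    orientation-ternary i j with adj G i j
    ... | false = there (here refl)
    ... | true with ⌊ i Fin.<? j ⌋
    ...   | true  = there (there (here refl))
    ...   | false = here refl

  seidelMatrices-nonempty : 0 ℕ.< length (seidelMatrices G)
  seidelMatrices-nonempty rewrite seidelMatrices≡ = ListP.filter-some (T? ∘ isSeidel G)
    (Any.map (λ {S} S≋o → subst T (sym (isSeidel-cong S≋o)) orientation-seidel)
             (∈-ternaryMatrices orientation orientation-ternary))

-- Determinants

det-suc : ∀ n (A : Mat (suc n) ℚ) →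
  det (suc n) A ≡ ∑[ j < suc n ] (signℚ (toℕ j) * (A zero j * det n (λ r c → A (suc r) (punchIn j c))))
det-suc n A = sumℚ-map-tabulate (λ j → signℚ (toℕ j) * (A zero j * det n (λ r c → A (suc r) (punchIn j c)))) id

det-cong : ∀ n {A B : Mat n ℚ} → (∀ i j → A i j ≡ B i j) → det n A ≡ det n B
det-cong zero    A≡B = refl
det-cong (suc n) {A} {B} A≡B = begin
  det (suc n) A ≡⟨ det-suc n A ⟩
  _             ≡⟨ sum-cong-≗ (λ j → cong₂ (λ a d → signℚ (toℕ j) * (a * d)) (A≡B zero j)
                                        (det-cong n (λ r c → A≡B (suc r) (punchIn j c)))) ⟩
  _             ≡⟨ det-suc n B ⟨
  det (suc n) B ∎

det-expand-col₀ : ∀ n (M : Mat (suc n) ℚ) →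
  det (suc n) M ≡ ∑[ r < suc n ] (signℚ (toℕ r) * (M r zero * det n (λ i c → M (punchIn r i) (suc c))))
det-expand-col₀ zero    M = det-suc zero M
det-expand-col₀ (suc k) M = begin
  det (suc (suc k)) M
    ≡⟨ det-suc (suc k) M ⟩
  T₀ + ∑[ j < suc k ] (signℚ (suc (toℕ j)) * (M zero (suc j) * det (suc k) (λ r c → M (suc r) (punchIn (suc j) c))))
    ≡⟨ cong (T₀ +_) (sum-cong-≗ λ j →
         trans (cong (λ d → signℚ (suc (toℕ j)) * (M zero (suc j) * d)) (det-expand-col₀ k (λ r c → M (suc r) (punchIn (suc j) c))))
               (*-distribˡ-sum₂ (signℚ (suc (toℕ j))) (M zero (suc j)) (λ r → signℚ (toℕ r) * (M (suc r) zero * D r j)))) ⟩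
  T₀ + ∑[ j < suc k ] ∑[ r < suc k ] (signℚ (suc (toℕ j)) * (M zero (suc j) * (signℚ (toℕ r) * (M (suc r) zero * D r j))))
    ≡⟨ cong (T₀ +_) (∑-comm (λ j r → signℚ (suc (toℕ j)) * (M zero (suc j) * (signℚ (toℕ r) * (M (suc r) zero * D r j))))) ⟩
  T₀ + ∑[ r < suc k ] ∑[ j < suc k ] (signℚ (suc (toℕ j)) * (M zero (suc j) * (signℚ (toℕ r) * (M (suc r) zero * D r j))))
    ≡⟨ cong (T₀ +_) (sum-cong-≗ λ r →
         trans (sum-cong-≗ λ j → swap-signs (toℕ j) (toℕ r) (M zero (suc j)) (M (suc r) zero) (D r j))
               (sym (*-distribˡ-sum₂ (signℚ (suc (toℕ r))) (M (suc r) zero) (λ j → signℚ (toℕ j) * (M zero (suc j) * D r j))))) ⟩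
  T₀ + ∑[ r < suc k ] (signℚ (suc (toℕ r)) * (M (suc r) zero * ∑[ j < suc k ] (signℚ (toℕ j) * (M zero (suc j) * D r j))))
    ≡⟨ cong (T₀ +_) (sum-cong-≗ λ r → cong (λ d → signℚ (suc (toℕ r)) * (M (suc r) zero * d))
                                           (sym (det-suc k (λ i c → M (punchIn (suc r) i) (suc c))))) ⟩
  T₀ + ∑[ r < suc k ] (signℚ (suc (toℕ r)) * (M (suc r) zero * det (suc k) (λ i c → M (punchIn (suc r) i) (suc c))))
    ∎
  where
  T₀ : ℚ
  T₀ = signℚ 0 * (M zero zero * det (suc k) (λ r c → M (suc r) (suc c)))
  D : Fin (suc k) → Fin (suc k) → ℚ
  D r j = det k (λ i c → M (suc (punchIn r i)) (suc (punchIn j c)))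
  swap-signs : ∀ a b x y d → signℚ (suc a) * (x * (signℚ b * (y * d))) ≡ signℚ (suc b) * (y * (signℚ a * (x * d)))
  swap-signs a b x y d rewrite signℚ-suc a | signℚ-suc b =
    solve 5 (λ sa sb x y d → (:- sa) :* (x :* (sb :* (y :* d))) := (:- sb) :* (y :* (sa :* (x :* d)))) refl (signℚ a) (signℚ b) x y d

-- Principal minors of xI - S

onPair : ∀ {n} → Fin n → Fin n → Fin n → Fin n → Bool
onPair u w i j = (i ==F u ∧ j ==F w) ∨ (i ==F w ∧ j ==F u)

onPair-sym : ∀ {n} (u w i j : Fin n) → onPair u w i j ≡ onPair u w j i
onPair-sym u w i j = trans (BoolP.∨-comm (i ==F u ∧ j ==F w) _)
  (cong₂ _∨_ (BoolP.∧-comm (i ==F w) (j ==F u)) (BoolP.∧-comm (i ==F u) (j ==F w)))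

onPair-here : ∀ {n} (u w : Fin n) → onPair u w u w ≡ true
onPair-here u w rewrite ==F-refl u | ==F-refl w = refl

onPair-elsewhere : ∀ {n} {u w a : Fin n} → u ≢ w → a ≢ w → onPair u w u a ≡ false
onPair-elsewhere {u = u} u≢w a≢w rewrite ==F-refl u | ==F-false a≢w | ==F-false u≢w = refl

onPair-off : ∀ {n} {u w i j : Fin n} → i ≢ u → j ≢ u → onPair u w i j ≡ false
onPair-off {w = w} {i} i≢u j≢u rewrite ==F-false i≢u | ==F-false j≢u = BoolP.∧-zeroʳ (i ==F w)

module Minors {n : ℕ} (G : Graph n) (x : ℚ) where

  charMatrix : Mat n ℤ → Mat n ℚ
  charMatrix S i j = (if i ==F j then x else 0ℚ) - fromℤ (S i j)

  minor : ∀ {m} (ρ γ : Fin m → Fin n) → Mat n ℤ → ℚ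
  minor {m} ρ γ S = det m (λ r c → charMatrix S (ρ r) (γ c))

  minor-resp : ∀ {m} (ρ γ : Fin m → Fin n) → minor ρ γ Preserves _≋ₘ_ ⟶ _≡_
  minor-resp {m} ρ γ S≋S′ = det-cong m λ r c → cong (λ z → (if ρ r ==F γ c then x else 0ℚ) - fromℤ z) (S≋S′ (ρ r) (γ c))

  module _ {S : Mat n ℤ} (S-seidel : T (isSeidel G S)) where

    open SeidelMatrix G S-seidel

    charMatrix-diagonal : ∀ i → charMatrix S i i ≡ x
    charMatrix-diagonal i rewrite ==F-refl i | diagonal i = ℚP.+-identityʳ x

    charMatrix-offdiagonal : ∀ {i j} → i ≢ j → charMatrix S i j ≡ - fromℤ (S i j)
    charMatrix-offdiagonal i≢j rewrite ==F-false i≢j = ℚP.+-identityˡ _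

    charMatrix-skew : ∀ {i j} → i ≢ j → charMatrix S i j ≡ fromℤ (S j i)
    charMatrix-skew {i} {j} i≢j = begin
      charMatrix S i j       ≡⟨ charMatrix-offdiagonal i≢j ⟩
      - fromℤ (S i j)        ≡⟨ cong (λ z → - fromℤ z) (skew i j) ⟩
      - fromℤ (ℤ.- S j i)    ≡⟨ cong -_ (fromℤ-neg (S j i)) ⟩
      - - fromℤ (S j i)      ≡⟨ solve 1 (λ q → :- (:- q) := q) refl (fromℤ (S j i)) ⟩
      fromℤ (S j i)          ∎

  module Step {m} (ι : Fin (suc (suc m)) → Fin n) (ι-injective : Injective _≡_ _≡_ ι) where

    u : Fin n
    u = ι zero

    w : Fin (suc m) → Fin n
    w j = ι (suc j)

    ι₊ : Fin (suc m) → Fin n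
    ι₊ = ι ∘ suc

    κ : Fin (suc m) → Fin m → Fin n
    κ j = ι ∘ suc ∘ punchIn j

    u≢w : ∀ j → u ≢ w j
    u≢w j u≡w with () ← ι-injective u≡w

    κ≢u : ∀ j i → κ j i ≢ u
    κ≢u j i = u≢w (punchIn j i) ∘ sym

    s : Fin (suc m) → Mat n ℤ → ℚ
    s j S = fromℤ (S u (w j))

    Φ : Fin (suc m) → Fin (suc m) → Mat n ℤ → ℚ
    Φ j r S = s j S * (s r S * minor (κ r) (κ j) S)

    coeff : Fin (suc m) → Fin (suc m) → ℚ
    coeff j r = - (signℚ (suc (toℕ j)) * signℚ (toℕ r))

    expand : ∀ {S} → T (isSeidel G S) →
      minor ι ι S ≡ x * minor ι₊ ι₊ S + ∑[ j < suc m ] ∑[ r < suc m ] (coeff j r * Φ j r S)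
    expand {S} S-seidel = begin
      minor ι ι S
        ≡⟨ det-suc (suc m) (λ r c → charMatrix S (ι r) (ι c)) ⟩
      signℚ 0 * (A u u * minor ι₊ ι₊ S) + ∑[ j < suc m ] (signℚ (suc (toℕ j)) * (A u (w j) * det (suc m) (M j)))
        ≡⟨ cong₂ _+_ first-term (sum-cong-≗ other-terms) ⟩
      x * minor ι₊ ι₊ S + ∑[ j < suc m ] ∑[ r < suc m ] (coeff j r * Φ j r S)
        ∎
      where
      A : Mat n ℚ
      A = charMatrix S
      M : Fin (suc m) → Mat (suc m) ℚ
      M j r c = A (w r) (ι (punchIn (suc j) c))
      first-term : signℚ 0 * (A u u * minor ι₊ ι₊ S) ≡ x * minor ι₊ ι₊ S
      first-term rewrite charMatrix-diagonal S-seidel u = ℚP.*-identityˡ _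
      other-terms : ∀ j → signℚ (suc (toℕ j)) * (A u (w j) * det (suc m) (M j)) ≡ ∑[ r < suc m ] (coeff j r * Φ j r S)
      other-terms j = begin
        signℚ (suc (toℕ j)) * (A u (w j) * det (suc m) (M j))
          ≡⟨ cong₂ (λ a d → signℚ (suc (toℕ j)) * (a * d)) (charMatrix-offdiagonal S-seidel (u≢w j)) (det-expand-col₀ m (M j)) ⟩
        signℚ (suc (toℕ j)) * (- s j S * ∑[ r < suc m ] (signℚ (toℕ r) * (M j r zero * minor (κ r) (κ j) S)))
          ≡⟨ cong (λ d → signℚ (suc (toℕ j)) * (- s j S * d))
                  (sum-cong-≗ λ r → cong (λ a → signℚ (toℕ r) * (a * minor (κ r) (κ j) S))
                                         (charMatrix-skew S-seidel (u≢w r ∘ sym))) ⟩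
        signℚ (suc (toℕ j)) * (- s j S * ∑[ r < suc m ] (signℚ (toℕ r) * (s r S * minor (κ r) (κ j) S)))
          ≡⟨ *-distribˡ-sum₂ (signℚ (suc (toℕ j))) (- s j S) (λ r → signℚ (toℕ r) * (s r S * minor (κ r) (κ j) S)) ⟩
        ∑[ r < suc m ] (signℚ (suc (toℕ j)) * (- s j S * (signℚ (toℕ r) * (s r S * minor (κ r) (κ j) S))))
          ≡⟨ sum-cong-≗ (λ r → solve 5 (λ a b p q d → a :* (:- p :* (b :* (q :* d))) := :- (a :* b) :* (p :* (q :* d))) refl
                          (signℚ (suc (toℕ j))) (signℚ (toℕ r)) (s j S) (s r S) (minor (κ r) (κ j) S)) ⟩
        ∑[ r < suc m ] (coeff j r * Φ j r S)
          ∎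

    Φ-odd : ∀ {j r} → r ≢ j → ∀ S → Φ j r (negateAt (onPair u (w j)) S) ≡ - Φ j r S
    Φ-odd {j} {r} r≢j S = begin
      fromℤ (negIf (onPair u (w j) u (w j)) (S u (w j))) * (fromℤ (negIf (onPair u (w j) u (w r)) (S u (w r))) * minor (κ r) (κ j) S′)
        ≡⟨ cong₂ (λ a b → fromℤ (negIf a (S u (w j))) * (fromℤ (negIf b (S u (w r))) * minor (κ r) (κ j) S′))
                 (onPair-here u (w j)) (onPair-elsewhere (u≢w j) (r≢j ∘ FinP.suc-injective ∘ ι-injective)) ⟩
      fromℤ (ℤ.- S u (w j)) * (s r S * minor (κ r) (κ j) S′)
        ≡⟨ cong₂ (λ a d → a * (s r S * d)) (fromℤ-neg (S u (w j)))
                 (det-cong m λ i c → cong (λ b → (if κ r i ==F κ j c then x else 0ℚ) - fromℤ (negIf b (S (κ r i) (κ j c))))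
                                          (onPair-off (κ≢u r i) (κ≢u j c))) ⟩
      - s j S * (s r S * minor (κ r) (κ j) S)
        ≡⟨ ℚP.neg-distribˡ-* (s j S) _ ⟨
      - Φ j r S
        ∎
      where
      S′ : Mat n ℤ
      S′ = negateAt (onPair u (w j)) S

    seidelSum-Φ-diagonal : ∀ j → coeff j j * seidelSum G (Φ j j) ≡ (if adj G u (w j) then seidelSum G (minor (κ j) (κ j)) else 0ℚ)
    seidelSum-Φ-diagonal j = begin
      coeff j j * seidelSum G (Φ j j)
        ≡⟨ cong₂ _*_ coeff-diagonal (seidelSum-cong G λ S S-seidel →
             trans (sym (ℚP.*-assoc (s j S) (s j S) _)) (cong (_* minor (κ j) (κ j) S) (SeidelMatrix.square G S-seidel u (w j)))) ⟩
      1ℚ * seidelSum G (λ S → (if adj G u (w j) then 1ℚ else 0ℚ) * minor (κ j) (κ j) S)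
        ≡⟨ trans (ℚP.*-identityˡ _) (sumℚ-map-* (if adj G u (w j) then 1ℚ else 0ℚ) (minor (κ j) (κ j)) (seidelMatrices G)) ⟩
      (if adj G u (w j) then 1ℚ else 0ℚ) * seidelSum G (minor (κ j) (κ j))
        ≡⟨ indicator (adj G u (w j)) ⟩
      (if adj G u (w j) then seidelSum G (minor (κ j) (κ j)) else 0ℚ)
        ∎
      where
      coeff-diagonal : coeff j j ≡ 1ℚ
      coeff-diagonal rewrite signℚ-suc (toℕ j) =
        trans (solve 1 (λ a → :- ((:- a) :* a) := a :* a) refl (signℚ (toℕ j))) (signℚ-square (toℕ j))
      indicator : ∀ b → (if b then 1ℚ else 0ℚ) * seidelSum G (minor (κ j) (κ j)) ≡ (if b then seidelSum G (minor (κ j) (κ j)) else 0ℚ)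
      indicator true  = ℚP.*-identityˡ _
      indicator false = ℚP.*-zeroˡ (seidelSum G (minor (κ j) (κ j)))

    Φ-resp : ∀ j r → Φ j r Preserves _≋ₘ_ ⟶ _≡_
    Φ-resp j r S≋S′ = cong₂ _*_ (cong fromℤ (S≋S′ u (w j)))
                               (cong₂ _*_ (cong fromℤ (S≋S′ u (w r))) (minor-resp (κ r) (κ j) S≋S′))

    seidelSum-minor-step : seidelSum G (minor ι ι) ≡
      x * seidelSum G (minor ι₊ ι₊) + ∑[ j < suc m ] (if adj G u (w j) then seidelSum G (minor (κ j) (κ j)) else 0ℚ)
    seidelSum-minor-step = begin
      seidelSum G (minor ι ι)
        ≡⟨ seidelSum-cong G (λ _ → expand) ⟩
      sumℚ (map (λ S → x * minor ι₊ ι₊ S + ∑[ j < suc m ] ∑[ r < suc m ] (coeff j r * Φ j r S)) seidels)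
        ≡⟨ sumℚ-map-+ _ _ seidels ⟩
      sumℚ (map (λ S → x * minor ι₊ ι₊ S) seidels)
        + sumℚ (map (λ S → ∑[ j < suc m ] ∑[ r < suc m ] (coeff j r * Φ j r S)) seidels)
        ≡⟨ cong₂ _+_ (sumℚ-map-* x (minor ι₊ ι₊) seidels)
             (trans (sumℚ-map-∑ (λ j S → ∑[ r < suc m ] (coeff j r * Φ j r S)) seidels) (sum-cong-≗ λ j →
                trans (sumℚ-map-∑ (λ r S → coeff j r * Φ j r S) seidels)
                      (sum-cong-≗ λ r → sumℚ-map-* (coeff j r) (Φ j r) seidels))) ⟩
      x * seidelSum G (minor ι₊ ι₊) + ∑[ j < suc m ] ∑[ r < suc m ] (coeff j r * seidelSum G (Φ j r))
        ≡⟨ cong (x * seidelSum G (minor ι₊ ι₊) +_) (sum-cong-≗ λ j →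
             ∑-δ (λ r → coeff j r * seidelSum G (Φ j r)) j λ r r≢j →
               trans (cong (coeff j r *_) (seidelSum-odd G (onPair-sym u (w j)) (Φ j r) (Φ-resp j r) (Φ-odd r≢j)))
                     (ℚP.*-zeroʳ (coeff j r))) ⟩
      x * seidelSum G (minor ι₊ ι₊) + ∑[ j < suc m ] (coeff j j * seidelSum G (Φ j j))
        ≡⟨ cong (x * seidelSum G (minor ι₊ ι₊) +_) (sum-cong-≗ seidelSum-Φ-diagonal) ⟩
      x * seidelSum G (minor ι₊ ι₊) + ∑[ j < suc m ] (if adj G u (w j) then seidelSum G (minor (κ j) (κ j)) else 0ℚ)
        ∎
      where
      seidels : List (Mat n ℤ)
      seidels = seidelMatrices G

-- Matchings

module _ {A : Set} where

  sublists-filterᵇ : (p : A → Bool) (xs : List A) → filterᵇ (all p) (sublists xs) ≡ sublists (filterᵇ p xs)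
  sublists-filterᵇ p []       = refl
  sublists-filterᵇ p (x ∷ xs) = begin
    filterᵇ (all p) (ys ++ map (x ∷_) ys)
      ≡⟨ filterᵇ-++ (all p) ys _ ⟩
    filterᵇ (all p) ys ++ filterᵇ (all p) (map (x ∷_) ys)
      ≡⟨ cong₂ _++_ (sublists-filterᵇ p xs) (filterᵇ-map (all p) (x ∷_) ys) ⟩
    sublists (filterᵇ p xs) ++ map (x ∷_) (filterᵇ (λ M → p x ∧ all p M) ys)
      ≡⟨ with-x ⟩
    sublists (filterᵇ p (x ∷ xs))
      ∎
    where
    ys : List (List A)
    ys = sublists xs
    with-x : sublists (filterᵇ p xs) ++ map (x ∷_) (filterᵇ (λ M → p x ∧ all p M) ys) ≡ sublists (filterᵇ p (x ∷ xs))
    with-x with p x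
    ... | true  = cong (λ zs → sublists (filterᵇ p xs) ++ map (x ∷_) zs) (sublists-filterᵇ p xs)
    ... | false = trans (cong (λ zs → sublists (filterᵇ p xs) ++ map (x ∷_) zs) (filterᵇ-none _ (λ _ → refl) ys))
                        (ListP.++-identityʳ _)

sublists-map : ∀ {A B : Set} (f : A → B) (xs : List A) → sublists (map f xs) ≡ map (map f) (sublists xs)
sublists-map f []       = refl
sublists-map {A} f (x ∷ xs) = begin
  sublists (map f xs) ++ map (f x ∷_) (sublists (map f xs))    ≡⟨ cong (λ zs → zs ++ map (f x ∷_) zs) (sublists-map f xs) ⟩
  map (map f) ys ++ map (f x ∷_) (map (map f) ys)              ≡⟨ cong (map (map f) ys ++_) (trans (sym (ListP.map-∘ ys)) (ListP.map-∘ ys)) ⟩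
  map (map f) ys ++ map (map f) (map (x ∷_) ys)                ≡⟨ ListP.map-++ (map f) ys _ ⟨
  map (map f) (ys ++ map (x ∷_) ys)                            ∎
  where
  ys : List (List A)
  ys = sublists xs

Edge : ℕ → Set
Edge N = Fin N × Fin N

module _ {N : ℕ} where

  isMatchingOfSize : ℕ → List (Edge N) → Bool
  isMatchingOfSize k M = pairwiseDisjoint M ∧ ⌊ length M ℕ.≟ k ⌋

  disjointFrom : Edge N → List (Edge N) → List (Edge N)
  disjointFrom e = filterᵇ (disjointEdges e)

  countMatchings : List (Edge N) → ℕ → ℕ
  countMatchings es k = length (filterᵇ (isMatchingOfSize k) (sublists es))

  countMatchings-∷ : ∀ e es k →
    countMatchings (e ∷ es) k ≡ countMatchings es k ℕ.+ length (filterᵇ (isMatchingOfSize k ∘ (e ∷_)) (sublists es))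
  countMatchings-∷ e es k = begin
    length (filterᵇ (isMatchingOfSize k) (ys ++ map (e ∷_) ys))
      ≡⟨ cong length (filterᵇ-++ (isMatchingOfSize k) ys _) ⟩
    length (filterᵇ (isMatchingOfSize k) ys ++ filterᵇ (isMatchingOfSize k) (map (e ∷_) ys))
      ≡⟨ ListP.length-++ (filterᵇ (isMatchingOfSize k) ys) ⟩
    countMatchings es k ℕ.+ length (filterᵇ (isMatchingOfSize k) (map (e ∷_) ys))
      ≡⟨ cong (countMatchings es k ℕ.+_) (trans (cong length (filterᵇ-map _ (e ∷_) ys))
                                                (ListP.length-map (e ∷_) (filterᵇ (isMatchingOfSize k ∘ (e ∷_)) ys))) ⟩
    countMatchings es k ℕ.+ length (filterᵇ (isMatchingOfSize k ∘ (e ∷_)) ys)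
      ∎
    where
    ys : List (List (Edge N))
    ys = sublists es

  countMatchings-zero : ∀ es → countMatchings es 0 ≡ 1
  countMatchings-zero []       = refl
  countMatchings-zero (e ∷ es) = begin
    countMatchings (e ∷ es) 0
      ≡⟨ countMatchings-∷ e es 0 ⟩
    countMatchings es 0 ℕ.+ length (filterᵇ (isMatchingOfSize 0 ∘ (e ∷_)) (sublists es))
      ≡⟨ cong₂ ℕ._+_ (countMatchings-zero es) (cong length (filterᵇ-none _ (λ M → BoolP.∧-zeroʳ _) (sublists es))) ⟩
    1
      ∎

  countMatchings-∷-suc : ∀ e es k →
    countMatchings (e ∷ es) (suc k) ≡ countMatchings es (suc k) ℕ.+ countMatchings (disjointFrom e es) k
  countMatchings-∷-suc e es k = trans (countMatchings-∷ e es (suc k)) (cong (countMatchings es (suc k) ℕ.+_) (begin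
    length (filterᵇ (isMatchingOfSize (suc k) ∘ (e ∷_)) ys)
      ≡⟨ cong length (filterᵇ-cong (λ M → trans (BoolP.∧-assoc (all (disjointEdges e) M) _ _)
           (cong (λ b → all (disjointEdges e) M ∧ (pairwiseDisjoint M ∧ b))
                 (⌊⌋-⇔ (mk⇔ ℕP.suc-injective (cong suc)) (suc (length M) ℕ.≟ suc k) (length M ℕ.≟ k)))) ys) ⟩
    length (filterᵇ (λ M → all (disjointEdges e) M ∧ isMatchingOfSize k M) ys)
      ≡⟨ cong length (filterᵇ-filterᵇ (isMatchingOfSize k) (all (disjointEdges e)) ys) ⟨
    length (filterᵇ (isMatchingOfSize k) (filterᵇ (all (disjointEdges e)) ys))
      ≡⟨ cong (length ∘ filterᵇ (isMatchingOfSize k)) (sublists-filterᵇ (disjointEdges e) es) ⟩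
    countMatchings (disjointFrom e es) k
      ∎))
    where
    ys : List (List (Edge N))
    ys = sublists es

module _ {N N′ : ℕ} (f : Edge N → Edge N′) (f-disjoint : ∀ e e′ → disjointEdges (f e) (f e′) ≡ disjointEdges e e′) where

  pairwiseDisjoint-map : ∀ M → pairwiseDisjoint (map f M) ≡ pairwiseDisjoint M
  pairwiseDisjoint-map []      = refl
  pairwiseDisjoint-map (e ∷ M) =
    cong₂ _∧_ (cong and (trans (sym (ListP.map-∘ M)) (ListP.map-cong (f-disjoint e) M))) (pairwiseDisjoint-map M)

  countMatchings-map : ∀ es k → countMatchings (map f es) k ≡ countMatchings es k
  countMatchings-map es k = begin
    length (filterᵇ (isMatchingOfSize k) (sublists (map f es)))
      ≡⟨ cong (length ∘ filterᵇ (isMatchingOfSize k)) (sublists-map f es) ⟩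
    length (filterᵇ (isMatchingOfSize k) (map (map f) (sublists es)))
      ≡⟨ cong length (filterᵇ-map _ (map f) (sublists es)) ⟩
    length (map (map f) (filterᵇ (isMatchingOfSize k ∘ map f) (sublists es)))
      ≡⟨ ListP.length-map (map f) (filterᵇ (isMatchingOfSize k ∘ map f) (sublists es)) ⟩
    length (filterᵇ (isMatchingOfSize k ∘ map f) (sublists es))
      ≡⟨ cong length (filterᵇ-cong (λ M → cong₂ (λ b l → b ∧ ⌊ l ℕ.≟ k ⌋) (pairwiseDisjoint-map M) (ListP.length-map f M))
                                   (sublists es)) ⟩
    countMatchings es k
      ∎

induce : ∀ {n m} → Graph n → (Fin m → Fin n) → Graph m
induce G ι = record
  { adj    = λ i j → adj G (ι i) (ι j)
  ; sym    = λ i j → Graph.sym G (ι i) (ι j)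
  ; irrefl = irrefl G ∘ ι
  }

punchInEdge : ∀ {m} → Fin (suc m) → Edge m → Edge (suc m)
punchInEdge j e = punchIn j (proj₁ e) , punchIn j (proj₂ e)

==F-punchIn : ∀ {m} (j : Fin (suc m)) (a b : Fin m) → (punchIn j a ==F punchIn j b) ≡ (a ==F b)
==F-punchIn j a b = ⌊⌋-⇔ (mk⇔ (FinP.punchIn-injective j a b) (cong (punchIn j))) _ _

<?-punchIn : ∀ {m} (j : Fin (suc m)) (a b : Fin m) → ⌊ punchIn j a Fin.<? punchIn j b ⌋ ≡ ⌊ a Fin.<? b ⌋
<?-punchIn j a b = ⌊⌋-⇔
  (mk⇔ (λ ja<jb → ℕP.≰⇒> (ℕP.<⇒≱ ja<jb ∘ FinP.punchIn-mono-≤ j b a))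
       (λ a<b → ℕP.≰⇒> (ℕP.<⇒≱ a<b ∘ FinP.punchIn-cancel-≤ j b a))) _ _

disjointEdges-punchIn : ∀ {m} (j : Fin (suc m)) (e e′ : Edge m) →
  disjointEdges (punchInEdge j e) (punchInEdge j e′) ≡ disjointEdges e e′
disjointEdges-punchIn j (a , b) (c , d)
  rewrite ==F-punchIn j a c | ==F-punchIn j a d | ==F-punchIn j b c | ==F-punchIn j b d = refl

allFin-suc : ∀ m → allFin (suc m) ≡ zero ∷ map suc (allFin m)
allFin-suc m = cong (zero ∷_) (sym (ListP.map-tabulate id suc))

_≠F_ : ∀ {m} → Fin m → Fin m → Bool
j ≠F c = not (j ==F c)

allFin-avoiding : ∀ m (j : Fin (suc m)) → filterᵇ (j ≠F_) (allFin (suc m)) ≡ map (punchIn j) (allFin m)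
allFin-avoiding m zero = begin
  filterᵇ (zero ≠F_) (allFin (suc m))      ≡⟨ cong (filterᵇ (zero ≠F_)) (allFin-suc m) ⟩
  filterᵇ (zero ≠F_) (map suc (allFin m))  ≡⟨ filterᵇ-map (zero ≠F_) suc (allFin m) ⟩
  map suc (filterᵇ (λ _ → true) (allFin m))     ≡⟨ cong (map suc) (filterᵇ-all _ (λ _ → refl) (allFin m)) ⟩
  map suc (allFin m)                            ∎
allFin-avoiding (suc m) (suc j) = begin
  filterᵇ (suc j ≠F_) (allFin (suc (suc m)))
    ≡⟨ cong (filterᵇ (suc j ≠F_)) (allFin-suc (suc m)) ⟩
  zero ∷ filterᵇ (suc j ≠F_) (map suc (allFin (suc m)))
    ≡⟨ cong (zero ∷_) (filterᵇ-map (suc j ≠F_) suc (allFin (suc m))) ⟩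
  zero ∷ map suc (filterᵇ ((suc j ≠F_) ∘ suc) (allFin (suc m)))
    ≡⟨ cong (λ cs → zero ∷ map suc cs) (filterᵇ-cong (λ c → cong not (==F-punchIn zero j c)) (allFin (suc m))) ⟩
  zero ∷ map suc (filterᵇ (j ≠F_) (allFin (suc m)))
    ≡⟨ cong (λ cs → zero ∷ map suc cs) (allFin-avoiding m j) ⟩
  zero ∷ map suc (map (punchIn j) (allFin m))
    ≡⟨ cong (zero ∷_) (trans (sym (ListP.map-∘ (allFin m))) (ListP.map-∘ (allFin m))) ⟩
  map (punchIn (suc j)) (zero ∷ map suc (allFin m))
    ≡⟨ cong (map (punchIn (suc j))) (allFin-suc m) ⟨
  map (punchIn (suc j)) (allFin (suc m))
    ∎

avoids : ∀ {m} → Fin m → Edge m → Bool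
avoids j e = j ≠F proj₁ e ∧ j ≠F proj₂ e

allPairs-avoiding : ∀ m (j : Fin (suc m)) → filterᵇ (avoids j) (allPairs (suc m)) ≡ map (punchInEdge j) (allPairs m)
allPairs-avoiding m j = begin
  filterᵇ (avoids j) (concatMap (λ a → map (a ,_) F₊) F₊)
    ≡⟨ filterᵇ-concatMap (avoids j) _ F₊ ⟩
  concatMap (λ a → filterᵇ (avoids j) (map (a ,_) F₊)) F₊
    ≡⟨ ListP.concatMap-cong row F₊ ⟩
  concatMap (λ a → if j ≠F a then map (a ,_) (map (punchIn j) F) else []) F₊
    ≡⟨ concatMap-filterᵇ (λ a → map (a ,_) (map (punchIn j) F)) (j ≠F_) F₊ ⟨
  concatMap (λ a → map (a ,_) (map (punchIn j) F)) (filterᵇ (j ≠F_) F₊)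
    ≡⟨ cong (concatMap _) (allFin-avoiding m j) ⟩
  concatMap (λ a → map (a ,_) (map (punchIn j) F)) (map (punchIn j) F)
    ≡⟨ ListP.concatMap-map _ (punchIn j) F ⟩
  concatMap (λ a → map (punchIn j a ,_) (map (punchIn j) F)) F
    ≡⟨ ListP.concatMap-cong (λ a → trans (sym (ListP.map-∘ F)) (ListP.map-∘ F)) F ⟩
  concatMap (λ a → map (punchInEdge j) (map (a ,_) F)) F
    ≡⟨ ListP.map-concatMap (punchInEdge j) _ F ⟨
  map (punchInEdge j) (allPairs m)
    ∎
  where
  F : List (Fin m)
  F = allFin m
  F₊ : List (Fin (suc m))
  F₊ = allFin (suc m)
  row : ∀ a → filterᵇ (avoids j) (map (a ,_) F₊) ≡ (if j ≠F a then map (a ,_) (map (punchIn j) F) else [])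
  row a = trans (filterᵇ-map (avoids j) (a ,_) F₊) (row′ (j ≠F a))
    where
    row′ : ∀ b → map (a ,_) (filterᵇ (λ c → b ∧ j ≠F c) F₊) ≡ (if b then map (a ,_) (map (punchIn j) F) else [])
    row′ false = cong (map (a ,_)) (filterᵇ-none _ (λ _ → refl) F₊)
    row′ true  = cong (map (a ,_)) (allFin-avoiding m j)

module _ {N : ℕ} (H : Graph N) where

  isEdge : Edge N → Bool
  isEdge e = adj H (proj₁ e) (proj₂ e) ∧ ⌊ proj₁ e Fin.<? proj₂ e ⌋

  edgesᵇ : List (Edge N)
  edgesᵇ = filterᵇ isEdge (allPairs N)

  matchingCount≡ : ∀ k → matchingCount H k ≡ countMatchings edgesᵇ k
  matchingCount≡ k = trans (cong length (filter-≡true (isMatchingOfSize k) (sublists (edges H))))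
                           (cong (λ es → countMatchings es k) (filter-≡true isEdge (allPairs N)))

isEdge-punchIn : ∀ {m} (H : Graph (suc m)) (j : Fin (suc m)) → isEdge H ∘ punchInEdge j ≗ isEdge (induce H (punchIn j))
isEdge-punchIn H j e = cong (adj H (punchIn j (proj₁ e)) (punchIn j (proj₂ e)) ∧_) (<?-punchIn j (proj₁ e) (proj₂ e))

edgesᵇ-avoiding : ∀ {m} (H : Graph (suc m)) (j : Fin (suc m)) →
  filterᵇ (avoids j) (edgesᵇ H) ≡ map (punchInEdge j) (edgesᵇ (induce H (punchIn j)))
edgesᵇ-avoiding {m} H j = begin
  filterᵇ (avoids j) (filterᵇ (isEdge H) (allPairs (suc m)))  ≡⟨ filterᵇ-filterᵇ (avoids j) (isEdge H) _ ⟩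
  filterᵇ (λ e → isEdge H e ∧ avoids j e) (allPairs (suc m))  ≡⟨ filterᵇ-cong (λ e → BoolP.∧-comm (isEdge H e) (avoids j e)) _ ⟩
  filterᵇ (λ e → avoids j e ∧ isEdge H e) (allPairs (suc m))  ≡⟨ filterᵇ-filterᵇ (isEdge H) (avoids j) _ ⟨
  filterᵇ (isEdge H) (filterᵇ (avoids j) (allPairs (suc m)))  ≡⟨ cong (filterᵇ (isEdge H)) (allPairs-avoiding m j) ⟩
  filterᵇ (isEdge H) (map (punchInEdge j) (allPairs m))       ≡⟨ filterᵇ-map (isEdge H) (punchInEdge j) (allPairs m) ⟩
  map (punchInEdge j) (filterᵇ (isEdge H ∘ punchInEdge j) (allPairs m))
    ≡⟨ cong (map (punchInEdge j)) (filterᵇ-cong (isEdge-punchIn H j) (allPairs m)) ⟩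
  map (punchInEdge j) (edgesᵇ (induce H (punchIn j)))       ∎

edgeFrom₀ : ∀ {N} → Fin N → Edge (suc N)
edgeFrom₀ j = zero , suc j

-- The star at 0 comes first because allPairs enumerates the pairs (0 , c) first.
edgesᵇ-split₀ : ∀ {N} (H : Graph (suc N)) →
  edgesᵇ H ≡ map edgeFrom₀ (filterᵇ (adj H zero ∘ suc) (allFin N)) ++ map (punchInEdge zero) (edgesᵇ (induce H suc))
edgesᵇ-split₀ {N} H = begin
  filterᵇ (isEdge H) (concatMap row (allFin (suc N)))
    ≡⟨ cong (filterᵇ (isEdge H)) (trans (cong (concatMap row) (allFin-suc N)) (cong (row zero ++_) (ListP.concatMap-map row suc F))) ⟩
  filterᵇ (isEdge H) (row zero ++ concatMap (row ∘ suc) F)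
    ≡⟨ filterᵇ-++ (isEdge H) (row zero) _ ⟩
  filterᵇ (isEdge H) (row zero) ++ filterᵇ (isEdge H) (concatMap (row ∘ suc) F)
    ≡⟨ cong₂ _++_ from₀ avoiding₀ ⟩
  map edgeFrom₀ (filterᵇ (adj H zero ∘ suc) F) ++ map (punchInEdge zero) (edgesᵇ H₀)
    ∎
  where
  F : List (Fin N)
  F = allFin N
  H₀ : Graph N
  H₀ = induce H suc
  row : Fin (suc N) → List (Edge (suc N))
  row i = map (i ,_) (allFin (suc N))
  row₀ : Fin N → List (Edge N)
  row₀ i = map (i ,_) F
  row-suc : ∀ i → row i ≡ (i , zero) ∷ map (λ c → i , suc c) F
  row-suc i = trans (cong (map (i ,_)) (allFin-suc N)) (cong ((i , zero) ∷_) (sym (ListP.map-∘ F)))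
  from₀ : filterᵇ (isEdge H) (row zero) ≡ map edgeFrom₀ (filterᵇ (adj H zero ∘ suc) F)
  from₀ = begin
    filterᵇ (isEdge H) (row zero)
      ≡⟨ cong (filterᵇ (isEdge H)) (row-suc zero) ⟩
    filterᵇ (isEdge H) ((zero , zero) ∷ map edgeFrom₀ F)
      ≡⟨ filterᵇ-reject (isEdge H) (map edgeFrom₀ F) (cong (_∧ false) (irrefl H zero)) ⟩
    filterᵇ (isEdge H) (map edgeFrom₀ F)
      ≡⟨ filterᵇ-map (isEdge H) edgeFrom₀ F ⟩
    map edgeFrom₀ (filterᵇ (isEdge H ∘ edgeFrom₀) F)
      ≡⟨ cong (map edgeFrom₀) (filterᵇ-cong (λ j → BoolP.∧-identityʳ (adj H zero (suc j))) F) ⟩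
    map edgeFrom₀ (filterᵇ (adj H zero ∘ suc) F)
      ∎
  from-suc : ∀ i → filterᵇ (isEdge H) (row (suc i)) ≡ map (punchInEdge zero) (filterᵇ (isEdge H₀) (row₀ i))
  from-suc i = begin
    filterᵇ (isEdge H) (row (suc i))
      ≡⟨ cong (filterᵇ (isEdge H)) (trans (row-suc (suc i)) (cong ((suc i , zero) ∷_) (ListP.map-∘ F))) ⟩
    filterᵇ (isEdge H) ((suc i , zero) ∷ map (punchInEdge zero) (row₀ i))
      ≡⟨ filterᵇ-reject (isEdge H) _ (BoolP.∧-zeroʳ (adj H (suc i) zero)) ⟩
    filterᵇ (isEdge H) (map (punchInEdge zero) (row₀ i))
      ≡⟨ filterᵇ-map (isEdge H) (punchInEdge zero) (row₀ i) ⟩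
    map (punchInEdge zero) (filterᵇ (isEdge H ∘ punchInEdge zero) (row₀ i))
      ≡⟨ cong (map (punchInEdge zero)) (filterᵇ-cong (isEdge-punchIn H zero) (row₀ i)) ⟩
    map (punchInEdge zero) (filterᵇ (isEdge H₀) (row₀ i))
      ∎
  avoiding₀ : filterᵇ (isEdge H) (concatMap (row ∘ suc) F) ≡ map (punchInEdge zero) (edgesᵇ H₀)
  avoiding₀ = begin
    filterᵇ (isEdge H) (concatMap (row ∘ suc) F)                 ≡⟨ filterᵇ-concatMap (isEdge H) (row ∘ suc) F ⟩
    concatMap (filterᵇ (isEdge H) ∘ row ∘ suc) F                 ≡⟨ ListP.concatMap-cong from-suc F ⟩
    concatMap (map (punchInEdge zero) ∘ filterᵇ (isEdge H₀) ∘ row₀) F ≡⟨ ListP.map-concatMap (punchInEdge zero) _ F ⟨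
    map (punchInEdge zero) (concatMap (filterᵇ (isEdge H₀) ∘ row₀) F) ≡⟨ cong (map (punchInEdge zero)) (filterᵇ-concatMap (isEdge H₀) row₀ F) ⟨
    map (punchInEdge zero) (edgesᵇ H₀)                            ∎

disjointEdges-edgeFrom₀ : ∀ {m} (j : Fin (suc m)) (e : Edge (suc m)) → disjointEdges (edgeFrom₀ j) (punchInEdge zero e) ≡ avoids j e
disjointEdges-edgeFrom₀ j e = cong₂ (λ p q → not p ∧ not q) (==F-punchIn zero j (proj₁ e)) (==F-punchIn zero j (proj₂ e))

-- Edges at vertex 0 pairwise intersect, so each step of countMatchings-∷-suc discards the rest of the star.
countMatchings-star₀ : ∀ {N} (js : List (Fin N)) (E : List (Edge (suc N))) k →
  fromℕ (countMatchings (map edgeFrom₀ js ++ E) (suc k)) ≡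
  fromℕ (countMatchings E (suc k)) + sumℚ (map (λ j → fromℕ (countMatchings (disjointFrom (edgeFrom₀ j) E) k)) js)
countMatchings-star₀ []       E k = sym (ℚP.+-identityʳ _)
countMatchings-star₀ {N} (j ∷ js) E k = begin
  fromℕ (countMatchings (edgeFrom₀ j ∷ E⁺) (suc k))
    ≡⟨ cong fromℕ (countMatchings-∷-suc (edgeFrom₀ j) E⁺ k) ⟩
  fromℕ (countMatchings E⁺ (suc k) ℕ.+ countMatchings (disjointFrom (edgeFrom₀ j) E⁺) k)
    ≡⟨ fromℕ-+ (countMatchings E⁺ (suc k)) _ ⟩
  fromℕ (countMatchings E⁺ (suc k)) + fromℕ (countMatchings (disjointFrom (edgeFrom₀ j) E⁺) k)
    ≡⟨ cong₂ _+_ (countMatchings-star₀ js E k) (cong (λ es → fromℕ (countMatchings es k)) star-disjoint) ⟩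
  (fromℕ (countMatchings E (suc k)) + rest) + this
    ≡⟨ solve 3 (λ a r t → (a :+ r) :+ t := a :+ (t :+ r)) refl (fromℕ (countMatchings E (suc k))) rest this ⟩
  fromℕ (countMatchings E (suc k)) + (this + rest)
    ∎
  where
  E⁺ : List (Edge (suc N))
  E⁺ = map edgeFrom₀ js ++ E
  this : ℚ
  this = fromℕ (countMatchings (disjointFrom (edgeFrom₀ j) E) k)
  rest : ℚ
  rest = sumℚ (map (λ j → fromℕ (countMatchings (disjointFrom (edgeFrom₀ j) E) k)) js)
  star-disjoint : disjointFrom (edgeFrom₀ j) E⁺ ≡ disjointFrom (edgeFrom₀ j) E
  star-disjoint = trans (filterᵇ-++ _ (map edgeFrom₀ js) E) (cong (_++ disjointFrom (edgeFrom₀ j) E)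
    (trans (filterᵇ-map _ edgeFrom₀ js) (cong (map edgeFrom₀) (filterᵇ-none _ (λ _ → refl) js))))

matchingCountℚ : ∀ {N} → Graph N → ℕ → ℚ
matchingCountℚ H k = fromℕ (matchingCount H k)

matchingCountℚ-zero : ∀ {N} (H : Graph N) → matchingCountℚ H 0 ≡ 1ℚ
matchingCountℚ-zero H = cong fromℕ (trans (matchingCount≡ H 0) (countMatchings-zero (edgesᵇ H)))

matchingCountℚ-suc : ∀ {m} (H : Graph (suc (suc m))) k →
  matchingCountℚ H (suc k) ≡
  matchingCountℚ (induce H suc) (suc k) + ∑[ j < suc m ] (if adj H zero (suc j) then matchingCountℚ (induce H (suc ∘ punchIn j)) k else 0ℚ)
matchingCountℚ-suc {m} H k = begin
  fromℕ (matchingCount H (suc k))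
    ≡⟨ cong fromℕ (trans (matchingCount≡ H (suc k)) (cong (λ es → countMatchings es (suc k)) (edgesᵇ-split₀ H))) ⟩
  fromℕ (countMatchings (map edgeFrom₀ js ++ E₀′) (suc k))
    ≡⟨ countMatchings-star₀ js E₀′ k ⟩
  fromℕ (countMatchings E₀′ (suc k)) + sumℚ (map (λ j → fromℕ (countMatchings (disjointFrom (edgeFrom₀ j) E₀′) k)) js)
    ≡⟨ cong₂ _+_ (cong fromℕ (trans (countMatchings-map (punchInEdge zero) (disjointEdges-punchIn zero) E₀ (suc k))
                                    (sym (matchingCount≡ H₀ (suc k)))))
                 (sumℚ-map-cong (λ j → cong fromℕ (neighbour j)) js) ⟩
  matchingCountℚ H₀ (suc k) + sumℚ (map (λ j → matchingCountℚ (H₋ j) k) js)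
    ≡⟨ cong (matchingCountℚ H₀ (suc k) +_) (trans (sumℚ-map-filterᵇ _ (adj H zero ∘ suc) (allFin (suc m)))
         (sumℚ-map-tabulate (λ j → if adj H zero (suc j) then matchingCountℚ (H₋ j) k else 0ℚ) id)) ⟩
  matchingCountℚ H₀ (suc k) + ∑[ j < suc m ] (if adj H zero (suc j) then matchingCountℚ (H₋ j) k else 0ℚ)
    ∎
  where
  H₀ : Graph (suc m)
  H₀ = induce H suc
  H₋ : Fin (suc m) → Graph m
  H₋ j = induce H (suc ∘ punchIn j)
  E₀ : List (Edge (suc m))
  E₀ = edgesᵇ H₀
  E₀′ : List (Edge (suc (suc m)))
  E₀′ = map (punchInEdge zero) E₀
  js : List (Fin (suc m))
  js = filterᵇ (adj H zero ∘ suc) (allFin (suc m))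
  neighbour : ∀ j → countMatchings (disjointFrom (edgeFrom₀ j) E₀′) k ≡ matchingCount (H₋ j) k
  neighbour j = begin
    countMatchings (disjointFrom (edgeFrom₀ j) E₀′) k
      ≡⟨ cong (λ es → countMatchings es k) (filterᵇ-map _ (punchInEdge zero) E₀) ⟩
    countMatchings (map (punchInEdge zero) (filterᵇ (disjointEdges (edgeFrom₀ j) ∘ punchInEdge zero) E₀)) k
      ≡⟨ countMatchings-map (punchInEdge zero) (disjointEdges-punchIn zero) (filterᵇ (disjointEdges (edgeFrom₀ j) ∘ punchInEdge zero) E₀) k ⟩
    countMatchings (filterᵇ (disjointEdges (edgeFrom₀ j) ∘ punchInEdge zero) E₀) k
      ≡⟨ cong (λ es → countMatchings es k) (filterᵇ-cong (disjointEdges-edgeFrom₀ j) E₀) ⟩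
    countMatchings (filterᵇ (avoids j) E₀) k
      ≡⟨ cong (λ es → countMatchings es k) (edgesᵇ-avoiding H₀ j) ⟩
    countMatchings (map (punchInEdge j) (edgesᵇ (induce H₀ (punchIn j)))) k
      ≡⟨ countMatchings-map (punchInEdge j) (disjointEdges-punchIn j) (edgesᵇ (induce H₀ (punchIn j))) k ⟩
    countMatchings (edgesᵇ (H₋ j)) k
      ≡⟨ matchingCount≡ (H₋ j) k ⟨
    matchingCount (H₋ j) k
      ∎

matchingCountℚ-vanishes : ∀ {N} (H : Graph N) k → N ℕ.< 2 ℕ.* k → matchingCountℚ H k ≡ 0ℚ
matchingCountℚ-vanishes {zero}        H (suc k) _ = refl
matchingCountℚ-vanishes {suc zero}    H (suc k) _ =
  cong fromℕ (trans (matchingCount≡ H (suc k)) (cong (λ es → countMatchings es (suc k)) (edgesᵇ-split₀ H)))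
matchingCountℚ-vanishes {suc (suc m)} H (suc k) N<2k = begin
  matchingCountℚ H (suc k)
    ≡⟨ matchingCountℚ-suc H k ⟩
  matchingCountℚ (induce H suc) (suc k) + ∑[ j < suc m ] (if adj H zero (suc j) then matchingCountℚ (induce H (suc ∘ punchIn j)) k else 0ℚ)
    ≡⟨ cong₂ _+_ (matchingCountℚ-vanishes (induce H suc) (suc k) (ℕP.<-trans (ℕP.n<1+n (suc m)) N<2k))
                 (∑-zero _ λ j → vanishes (adj H zero (suc j)) (induce H (suc ∘ punchIn j))) ⟩
  0ℚ + 0ℚ
    ≡⟨⟩
  0ℚ
    ∎
  where
  m<2k : m ℕ.< 2 ℕ.* k
  m<2k = ℕP.≤-pred (ℕP.≤-pred (subst (suc (suc m) ℕ.<_) (ℕP.*-suc 2 k) N<2k))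
  vanishes : ∀ b (Hⱼ : Graph m) → (if b then matchingCountℚ Hⱼ k else 0ℚ) ≡ 0ℚ
  vanishes true  Hⱼ = matchingCountℚ-vanishes Hⱼ k m<2k
  vanishes false Hⱼ = refl

-- The matching polynomial

<2*suc⌊/2⌋ : ∀ N → N ℕ.< 2 ℕ.* suc ⌊ N /2⌋
<2*suc⌊/2⌋ zero          = ℕ.s≤s ℕ.z≤n
<2*suc⌊/2⌋ (suc zero)    = ℕ.s≤s (ℕ.s≤s ℕ.z≤n)
<2*suc⌊/2⌋ (suc (suc N)) = subst (suc (suc N) ℕ.<_) (sym (ℕP.*-suc 2 (suc ⌊ N /2⌋))) (ℕ.s≤s (ℕ.s≤s (<2*suc⌊/2⌋ N)))

module MatchingPolynomial (x : ℚ) where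

  term : ∀ {N} → Graph N → ℕ → ℚ
  term {N} H k = matchingCountℚ H k * powℚ x (N ∸ 2 ℕ.* k)

  term-zero : ∀ {N} (H : Graph N) → term H 0 ≡ powℚ x N
  term-zero H = trans (cong (_* _) (matchingCountℚ-zero H)) (ℚP.*-identityˡ _)

  matchingPolyAt-padded : ∀ {N} (H : Graph N) K → ⌊ N /2⌋ ℕ.< K → matchingPolyAt H x ≡ ∑[ k < K ] term H (toℕ k)
  matchingPolyAt-padded {N} H K ⌊N/2⌋<K = begin
    matchingPolyAt H x                  ≡⟨ sumℚ-map-applyUpTo (term H) id K₀ ⟩
    ∑[ k < K₀ ] term H (toℕ k)          ≡⟨ ∑-pad K₀ (K ∸ K₀) (term H) vanishes ⟨
    ∑[ k < K₀ ℕ.+ (K ∸ K₀) ] term H (toℕ k) ≡⟨ cong (λ K′ → ∑[ k < K′ ] term H (toℕ k)) (ℕP.m+[n∸m]≡n ⌊N/2⌋<K) ⟩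
    ∑[ k < K ] term H (toℕ k)           ∎
    where
    K₀ : ℕ
    K₀ = suc ⌊ N /2⌋
    vanishes : ∀ i → term H (K₀ ℕ.+ i) ≡ 0ℚ
    vanishes i = trans (cong (_* _) (matchingCountℚ-vanishes H (K₀ ℕ.+ i)
                         (ℕP.<-≤-trans (<2*suc⌊/2⌋ N) (ℕP.*-monoʳ-≤ 2 (ℕP.m≤m+n K₀ i)))))
                       (ℚP.*-zeroˡ (powℚ x (N ∸ 2 ℕ.* (K₀ ℕ.+ i))))

  -- With truncated subtraction the exponent only shifts when K ≤ M; otherwise c must vanish.
  shift : ∀ c M K → (M ℕ.< K → c ≡ 0ℚ) → x * (c * powℚ x (M ∸ K)) ≡ c * powℚ x (suc M ∸ K)
  shift c M K c≡0 with K ℕ.≤? M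
  ... | yes K≤M = trans (solve 3 (λ x c p → x :* (c :* p) := c :* (x :* p)) refl x c (powℚ x (M ∸ K)))
                        (cong (λ e → c * powℚ x e) (sym (ℕP.+-∸-assoc 1 K≤M)))
  ... | no  K≰M rewrite c≡0 (ℕP.≰⇒> K≰M) =
          trans (cong (x *_) (ℚP.*-zeroˡ (powℚ x (M ∸ K)))) (trans (ℚP.*-zeroʳ x) (sym (ℚP.*-zeroˡ (powℚ x (suc M ∸ K)))))

  matchingPolyAt-suc : ∀ {m} (H : Graph (suc (suc m))) →
    matchingPolyAt H x ≡
    x * matchingPolyAt (induce H suc) x + ∑[ j < suc m ] (if adj H zero (suc j) then matchingPolyAt (induce H (suc ∘ punchIn j)) x else 0ℚ)
  matchingPolyAt-suc {m} H = begin
    matchingPolyAt H x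
      ≡⟨ matchingPolyAt-padded H (suc (suc m)) (ℕP.⌊n/2⌋<n (suc m)) ⟩
    term H 0 + ∑[ k < suc m ] term H (suc (toℕ k))
      ≡⟨ cong₂ _+_ (term-zero H) (sum-cong-≗ {suc m} (term-suc ∘ toℕ)) ⟩
    x * powℚ x (suc m) + ∑[ k < suc m ] (x * t₀ k + ∑[ j < suc m ] t₋ j k)
      ≡⟨ cong (x * powℚ x (suc m) +_) (trans (∑-distrib-+ (λ k → x * t₀ k) (λ k → ∑[ j < suc m ] t₋ j k))
           (cong₂ _+_ (sym (*-distribˡ-sum x t₀)) (∑-comm (λ k j → t₋ j k)))) ⟩
    x * powℚ x (suc m) + (x * sum t₀ + ∑[ j < suc m ] sum (t₋ j))
      ≡⟨ solve 4 (λ x p s r → x :* p :+ (x :* s :+ r) := x :* (p :+ s) :+ r) refl x (powℚ x (suc m)) (sum t₀) (∑[ j < suc m ] sum (t₋ j)) ⟩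
    x * (powℚ x (suc m) + sum t₀) + ∑[ j < suc m ] sum (t₋ j)
      ≡⟨ cong₂ (λ p q → x * p + q)
           (trans (cong (_+ sum t₀) (sym (term-zero H₀))) (sym (matchingPolyAt-padded H₀ (suc (suc m)) (ℕP.m≤n⇒m≤1+n (ℕP.⌊n/2⌋<n m)))))
           (sum-cong-≗ λ j → trans (∑-if {suc m} (a j) (term (H₋ j) ∘ toℕ))
                                   (cong (if a j then_else 0ℚ) (sym (matchingPolyAt-padded (H₋ j) (suc m) (ℕ.s≤s (ℕP.⌊n/2⌋≤n m)))))) ⟩
    x * matchingPolyAt H₀ x + ∑[ j < suc m ] (if a j then matchingPolyAt (H₋ j) x else 0ℚ)
      ∎
    where
    H₀ : Graph (suc m)
    H₀ = induce H suc
    H₋ : Fin (suc m) → Graph m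
    H₋ j = induce H (suc ∘ punchIn j)
    a : Fin (suc m) → Bool
    a j = adj H zero (suc j)
    t₀ : Fin (suc m) → ℚ
    t₀ k = term H₀ (suc (toℕ k))
    t₋ : Fin (suc m) → Fin (suc m) → ℚ
    t₋ j k = if a j then term (H₋ j) (toℕ k) else 0ℚ
    term-suc : ∀ k → term H (suc k) ≡ x * term H₀ (suc k) + ∑[ j < suc m ] (if a j then term (H₋ j) k else 0ℚ)
    term-suc k = begin
      matchingCountℚ H (suc k) * P
        ≡⟨ cong (_* P) (matchingCountℚ-suc H k) ⟩
      (matchingCountℚ H₀ (suc k) + ∑[ j < suc m ] c₋ j) * P
        ≡⟨ ℚP.*-distribʳ-+ P (matchingCountℚ H₀ (suc k)) _ ⟩
      matchingCountℚ H₀ (suc k) * P + (∑[ j < suc m ] c₋ j) * P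
        ≡⟨ cong₂ _+_ (sym (shift _ (suc m) (2 ℕ.* suc k) (matchingCountℚ-vanishes H₀ (suc k))))
                     (trans (*-distribʳ-sum P c₋) (sum-cong-≗ λ j →
                       trans (if-*ʳ (a j) (matchingCountℚ (H₋ j) k) P)
                             (cong (λ e → if a j then matchingCountℚ (H₋ j) k * powℚ x e else 0ℚ) m∸2k))) ⟩
      x * term H₀ (suc k) + ∑[ j < suc m ] (if a j then term (H₋ j) k else 0ℚ)
        ∎
      where
      P : ℚ
      P = powℚ x (suc (suc m) ∸ 2 ℕ.* suc k)
      c₋ : Fin (suc m) → ℚ
      c₋ j = if a j then matchingCountℚ (H₋ j) k else 0ℚ
      m∸2k : suc (suc m) ∸ 2 ℕ.* suc k ≡ m ∸ 2 ℕ.* k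
      m∸2k = cong (suc (suc m) ∸_) (ℕP.*-suc 2 k)

  matchingPolyAt-0 : (H : Graph 0) → matchingPolyAt H x ≡ 1ℚ
  matchingPolyAt-0 H = cong (λ c → c * 1ℚ + 0ℚ) (matchingCountℚ-zero H)

  matchingPolyAt-1 : (H : Graph 1) → matchingPolyAt H x ≡ x
  matchingPolyAt-1 H = trans (cong (λ c → c * (x * 1ℚ) + 0ℚ) (matchingCountℚ-zero H))
                             (solve 1 (λ x → con 1ℚ :* (x :* con 1ℚ) :+ con 0ℚ := x) refl x)

module _ {n : ℕ} (G : Graph n) (x : ℚ) where

  open Minors G x
  open MatchingPolynomial x

  seidelSum-minor : ∀ {m} (ι : Fin m → Fin n) → Injective _≡_ _≡_ ι →
    seidelSum G (minor ι ι) ≡ matchingPolyAt (induce G ι) x * seidelCount G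
  seidelSum-minor {zero} ι _ = begin
    seidelSum G (λ _ → 1ℚ)                         ≡⟨ seidelSum-const G 1ℚ ⟩
    1ℚ * seidelCount G                             ≡⟨ cong (_* seidelCount G) (matchingPolyAt-0 (induce G ι)) ⟨
    matchingPolyAt (induce G ι) x * seidelCount G  ∎
  seidelSum-minor {suc zero} ι _ = begin
    seidelSum G (minor ι ι)
      ≡⟨ seidelSum-cong G (λ S S-seidel → cong (λ a → 1ℚ * (a * 1ℚ) + 0ℚ) (charMatrix-diagonal S-seidel (ι zero))) ⟩
    seidelSum G (λ _ → 1ℚ * (x * 1ℚ) + 0ℚ)
      ≡⟨ seidelSum-const G (1ℚ * (x * 1ℚ) + 0ℚ) ⟩
    (1ℚ * (x * 1ℚ) + 0ℚ) * seidelCount G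
      ≡⟨ cong (_* seidelCount G) (trans (solve 1 (λ x → con 1ℚ :* (x :* con 1ℚ) :+ con 0ℚ := x) refl x)
                                        (sym (matchingPolyAt-1 (induce G ι)))) ⟩
    matchingPolyAt (induce G ι) x * seidelCount G
      ∎
  seidelSum-minor {suc (suc m)} ι ι-injective = begin
    seidelSum G (minor ι ι)
      ≡⟨ seidelSum-minor-step ⟩
    x * seidelSum G (minor ι₊ ι₊) + ∑[ j < suc m ] (if a j then seidelSum G (minor (κ j) (κ j)) else 0ℚ)
      ≡⟨ cong₂ (λ p q → x * p + q) (seidelSum-minor ι₊ (FinP.suc-injective ∘ ι-injective)) (sum-cong-≗ λ j → induction j (a j)) ⟩
    x * (matchingPolyAt H₀ x * c) + ∑[ j < suc m ] ((if a j then matchingPolyAt (H₋ j) x else 0ℚ) * c)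
      ≡⟨ cong (x * (matchingPolyAt H₀ x * c) +_) (*-distribʳ-sum c (λ j → if a j then matchingPolyAt (H₋ j) x else 0ℚ)) ⟨
    x * (matchingPolyAt H₀ x * c) + (∑[ j < suc m ] (if a j then matchingPolyAt (H₋ j) x else 0ℚ)) * c
      ≡⟨ solve 4 (λ x p c q → x :* (p :* c) :+ q :* c := (x :* p :+ q) :* c) refl x (matchingPolyAt H₀ x) c _ ⟩
    (x * matchingPolyAt H₀ x + ∑[ j < suc m ] (if a j then matchingPolyAt (H₋ j) x else 0ℚ)) * c
      ≡⟨ cong (_* c) (matchingPolyAt-suc (induce G ι)) ⟨
    matchingPolyAt (induce G ι) x * c
      ∎
    where
    open Step ι ι-injective
    c : ℚ
    c = seidelCount G
    H₀ : Graph (suc m)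
    H₀ = induce G ι₊
    H₋ : Fin (suc m) → Graph m
    H₋ j = induce G (κ j)
    a : Fin (suc m) → Bool
    a j = adj G u (w j)
    induction : ∀ j b → (if b then seidelSum G (minor (κ j) (κ j)) else 0ℚ) ≡ (if b then matchingPolyAt (H₋ j) x else 0ℚ) * c
    induction j true  = seidelSum-minor (κ j) (FinP.punchIn-injective j _ _ ∘ FinP.suc-injective ∘ ι-injective)
    induction j false = sym (ℚP.*-zeroˡ c)

theorem7p8 : (n : ℕ) (G : Graph n) (x : ℚ) → expectedCharPolyAt G x ≡ matchingPolyAt G x
theorem7p8 n G x = mean-≡ charPolys (matchingPolyAt G x)
  (subst (0 ℕ.<_) (sym length-charPolys) (seidelMatrices-nonempty G))
  (trans (seidelSum-minor G x id (λ ι≡ → ι≡)) (cong (λ l → matchingPolyAt G x * fromℕ l) (sym length-charPolys)))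
  where
  charPolys : List ℚ
  charPolys = map (λ S → charPolyAt S x) (seidelMatrices G)
  length-charPolys : length charPolys ≡ length (seidelMatrices G)
  length-charPolys = ListP.length-map (λ S → charPolyAt S x) (seidelMatrices G)
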